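{- Let $k\ge3$, $V=\{x_1,\dots,x_k\}$, and let $C=\ell_1\vee\cdots\vee\ell_k$ be a clause of width $k$ over $V$. Let $\alpha_{\mathsf{start}},\alpha_{\mathsf{end}}\colon V\to\{0,1\}$ be assignments each of which makes exactly one literal of $C$ true, and suppose $\alpha_{\mathsf{start}}\ne\alpha_{\mathsf{end}}$. Let $\alpha_{\mathsf{rand}}\colon V\to\{0,1\}$ be uniformly random and, conditioned on it, let $\vec{\alpha_1}$ and $\vec{\alpha_2}$ be uniformly random from $\mathscr{A}(\alpha_{\mathsf{start}}\leftrightsquigarrow\alpha_{\mathsf{rand}})$ and $\mathscr{A}(\alpha_{\mathsf{rand}}\leftrightsquigarrow\alpha_{\mathsf{end}})$, respectively. Then, with $K:=k-2$, $$\Pr\bigl[\vec{\alpha_1}\circ\vec{\alpha_2}\text{ satisfies } C\bigr]=\sum_{0\le j\le K}\frac14\cdot\frac{\binom{K}{j}}{2^K}\left[\left(\frac{j}{j+1}\right)^2+\frac{j+1}{j+2}+\frac{j+1}{j+2}+1\right]\ge1-\frac{1}{k-1}-\frac1k.$$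
   Context: A reconfiguration sequence from $\alpha$ to $\beta$ is a sequence of assignments starting at $\alpha$, ending at $\beta$, consecutive ones differing in at most one variable; it satisfies $C$ if every assignment in it satisfies $C$. A reconfiguration sequence $(\alpha^{(1)},\dots,\alpha^{(T)})$ from $\alpha$ to $\beta$ is irredundant if no two consecutive assignments are identical and for each variable $x_i$ there is $t_i$ with $\alpha^{(t)}(x_i)=\alpha(x_i)$ for $t\le t_i$ and $\alpha^{(t)}(x_i)=\beta(x_i)$ for $t>t_i$. $\mathscr{A}(\alpha\leftrightsquigarrow\beta)$ denotes the set of irredundant reconfiguration sequences from $\alpha$ to $\beta$; $\circ$ denotes concatenation. -}

module Defs where

open import Data.Bool using (Bool; true; false; not; if_then_else_)
open import Data.Nat as ℕ using (ℕ; zero; suc; _∸_; _^_)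
open import Data.Nat.Combinatorics using (_C_)
open import Data.Integer using (+_)
open import Data.Fin using (Fin; toℕ)
open import Data.Vec using (Vec; []; _∷_; lookup)
open import Data.List as List using (List; []; _∷_; _++_; length; allFin; upTo)
open import Data.List.Relation.Unary.Linked using (Linked)
open import Data.Maybe using (just)
open import Data.Bool.ListAction using (any; all)
open import Data.Product using (Σ; ∃; ∃-syntax; _×_)
open import Data.Rational as ℚ using (ℚ; 0ℚ; 1ℚ)
open import Relation.Binary.PropositionalEquality using (_≡_; _≢_)

-- Variables x_1..x_k are Fin k; an assignment V → {0,1} is a Vec Bool k
-- (true = 1, false = 0).
Assignment : ℕ → Set
Assignment k = Vec Bool k

-- A literal: a variable together with its polarity (true = positive x, false = ¬x).
Literal : ℕ → Set
Literal k = Fin k × Bool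

litVal : ∀ {k} → Assignment k → Literal k → Bool
litVal α (v Data.Product., b) = if b then lookup α v else not (lookup α v)

Clause : ℕ → Set
Clause k = Fin k → Literal k

ClauseDistinctVars : ∀ {k} → Clause k → Set
ClauseDistinctVars {k} ℓ = ∀ (i j : Fin k) → Data.Product.proj₁ (ℓ i) ≡ Data.Product.proj₁ (ℓ j) → i ≡ j

satC : ∀ {k} → Clause k → Assignment k → Bool
satC {k} ℓ α = any (λ i → litVal α (ℓ i)) (allFin k)

ExactlyOneTrue : ∀ {k} → Clause k → Assignment k → Set
ExactlyOneTrue {k} ℓ α =
  ∃[ i ] (litVal α (ℓ i) ≡ true × (∀ (j : Fin k) → j ≢ i → litVal α (ℓ j) ≡ false))

seqSat : ∀ {k} → Clause k → List (Assignment k) → Bool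
seqSat ℓ s = all (satC ℓ) s

DifferAtMostOne : ∀ {k} → Assignment k → Assignment k → Set
DifferAtMostOne {k} a b = ∃[ i ] (∀ (j : Fin k) → j ≢ i → lookup a j ≡ lookup b j)

-- Reconfiguration sequence from α to β (positions are 0-based: list index t
-- corresponds to α^(t+1) in the paper).
IsReconfSeq : ∀ {k} → Assignment k → Assignment k → List (Assignment k) → Set
IsReconfSeq α β s =
  List.head s ≡ just α × List.last s ≡ just β × Linked DifferAtMostOne s

Irredundant : ∀ {k} → Assignment k → Assignment k → List (Assignment k) → Set
Irredundant {k} α β s =
  IsReconfSeq α β s
  × Linked _≢_ s
  × (∀ (i : Fin k) → ∃[ tᵢ ]
       (∀ (t : Fin (length s)) →
          (toℕ t ℕ.< tᵢ → lookup (List.lookup s t) i ≡ lookup α i)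
        × (tᵢ ℕ.≤ toℕ t → lookup (List.lookup s t) i ≡ lookup β i)))

allAssign : (n : ℕ) → List (Assignment n)
allAssign zero = [] ∷ []
allAssign (suc n) = List.map (true ∷_) (allAssign n) ++ List.map (false ∷_) (allAssign n)

ℚsum : List ℚ → ℚ
ℚsum = List.foldr ℚ._+_ 0ℚ

-- n / d for naturals (d = 0 gives 0; only used with positive d)
_/ℕ_ : ℕ → ℕ → ℚ
n /ℕ zero = 0ℚ
n /ℕ suc d = (+ n) ℚ./ suc d

-- uniform average of f over a finite list (expectation under the uniform
-- distribution on the list's entries); 0 for an empty list
avg : ∀ {A : Set} → List A → (A → ℚ) → ℚ
avg xs f = ℚsum (List.map f xs) ℚ.* (1 /ℕ length xs)

indicator : Bool → ℚ
indicator true = 1ℚ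
indicator false = 0ℚ

-- Pr[ α₁ ∘ α₂ satisfies C ], where α_rand is uniform over all assignments and,
-- given α_rand, α₁ and α₂ are uniform (independently) over the lists
-- E α_start α_rand and E α_rand α_end, which enumerate 𝒜(·⇝·).
prSat : ∀ {k} → Clause k → (Assignment k → Assignment k → List (List (Assignment k)))
      → Assignment k → Assignment k → ℚ
prSat {k} ℓ E αs αe =
  avg (allAssign k) λ αr →
    avg (E αs αr) λ s₁ →
      avg (E αr αe) λ s₂ →
        indicator (seqSat ℓ (s₁ ++ s₂))

formula : ℕ → ℚ
formula K = ℚsum (List.map term (upTo (suc K)))
  where
  term : ℕ → ℚ
  term j = (1 /ℕ 4) ℚ.* ((K C j) /ℕ (2 ^ K)) ℚ.*
           (((j /ℕ suc j) ℚ.* (j /ℕ suc j)) ℚ.+ (suc j /ℕ suc (suc j))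
             ℚ.+ (suc j /ℕ suc (suc j)) ℚ.+ 1ℚ)

-- A clause of width k on k distinct variables is falsified by exactly one assignment z, and the
-- assignments making exactly one literal true are its neighbours z [ a ]%= not; so α₁ ∘ α₂
-- satisfies C iff neither path visits z.  Every assignment on an irredundant path from α to β
-- lies coordinatewise between α and β, and splitting the paths by their first flip shows that
-- there are dist α β ! of them, of which dist α z ! · dist z β ! pass through z when z lies
-- between α and β (and none otherwise).  Hence a random path from z [ a ]%= not to α_rand
-- avoids z with probability w / (w + 1) if α_rand agrees with z at a, where w = dist α_rand z,
-- and with probability 1 otherwise; the same holds for the path into z [ b ]%= not.  Grouping
-- α_rand by its values at a and b and by its distance to z on the remaining K coordinates
-- gives the binomial sum.  For the bound, the bracket is at least 4 − 2/(j+1) − 2/(j+2), and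
-- C(K,j)/(j+1) = C(K+1,j+1)/(K+1), C(K,j)/(j+2) ≤ C(K+1,j+1)/(K+2), Σⱼ C(K+1,j+1) < 2^(K+1).

module Submission where

open import Defs
open import Data.Bool as Bool using (Bool; true; false; not; _∧_; _∨_; _xor_)
open import Data.Bool.ListAction using (all; any)
import Data.Bool.Properties as BoolP
open import Data.Empty using (⊥-elim)
open import Data.Fin as Fin using (Fin; zero; suc; toℕ; punchOut)
import Data.Fin.Properties as FinP
open import Data.Integer as ℤ using (+_)
import Data.Integer.Properties as ℤP
open import Data.List as List using (List; []; _∷_; _++_; length; map; concatMap; allFin; tabulate; applyUpTo)
import Data.List.Properties as ListP
open import Data.List.Membership.Propositional using (_∈_; lose)
open import Data.List.Membership.Propositional.Properties using (∈-map⁺; ∈-map⁻; ∈-allFin; ∈-concatMap⁺; ∈-concatMap⁻)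
open import Data.List.Membership.Propositional.Properties.WithK using (unique∧set⇒bag)
open import Data.List.Relation.Binary.BagAndSetEquality using (∼bag⇒↭)
open import Data.List.Relation.Binary.Disjoint.Propositional using (Disjoint)
open import Data.List.Relation.Binary.Permutation.Propositional using (_↭_)
import Data.List.Relation.Binary.Permutation.Propositional.Properties as PermP
open import Data.List.Relation.Unary.All using ([])
import Data.List.Relation.Unary.All.Properties as AllP
open import Data.List.Relation.Unary.AllPairs as AllPairs using ([]; _∷_)
import Data.List.Relation.Unary.AllPairs.Properties as AllPairsP
open import Data.List.Relation.Unary.Any using (here; there; index; satisfied)
open import Data.List.Relation.Unary.Any.Properties using (lookup-index)
open import Data.List.Relation.Unary.Linked using ([-]; _∷_)
open import Data.List.Relation.Unary.Unique.Propositional using (Unique)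
import Data.List.Relation.Unary.Unique.Propositional.Properties as UniqueP
open import Data.Maybe using (just)
import Data.Maybe.Properties as MaybeP
open import Data.Nat as ℕ using (ℕ; zero; suc; z≤n; s≤s; _≤_; _∸_; _^_; _!; NonZero)
import Data.Nat.Properties as ℕP
open import Data.Nat.Properties using (_!≢0)
open import Data.Nat.Combinatorics using (_C_; nC1≡n; nCk+nC[k+1]≡[n+1]C[k+1])
open import Data.Nat.ListAction using (sum)
open import Data.Nat.ListAction.Properties using (sum-++; sum-↭)
open import Data.Nat.Tactic.RingSolver using (solve-∀)
open import Data.Product using (_×_; _,_; proj₁; proj₂; ∃; ∃-syntax)
open import Data.Rational as ℚ using (ℚ; 0ℚ; 1ℚ)
import Data.Rational.Properties as ℚP
open import Data.Rational.Solver using (module +-*-Solver)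
open import Data.Rational.Unnormalised as ℚᵘ using (mkℚᵘ; *≡*; *≤*)
import Data.Rational.Unnormalised.Properties as ℚᵘP
open import Data.Sum using (_⊎_; inj₁; inj₂; [_,_]′)
open import Data.Vec as Vec using ([]; _∷_; lookup; _[_]%=_)
import Data.Vec.Properties as VecP
open import Function using (_∘_; id; case_of_; mk⇔)
open import Relation.Nullary using (yes; no; ¬_)
open import Relation.Binary.PropositionalEquality
open import Algebra.Bundles using (CommutativeMonoid; Ring)
open import Algebra.Properties.CommutativeSemigroup (CommutativeMonoid.commutativeSemigroup ℚP.+-0-commutativeMonoid) using (interchange)
import Algebra.Properties.Semiring.Sum ℕP.+-*-semiring as ℕΣ
import Algebra.Properties.Semiring.Sum (Ring.semiring ℚP.+-*-ring) as ℚΣ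
open ℚΣ using (sum-syntax)

private
  toℚᵘ-/ℕ : ∀ m a → ℚ.toℚᵘ (m /ℕ suc a) ℚᵘ.≃ mkℚᵘ (+ m) a
  toℚᵘ-/ℕ m a = ℚP.toℚᵘ-fromℚᵘ (mkℚᵘ (+ m) a)

/ℕ-cross-≡ : ∀ {m n a b} .{{_ : NonZero a}} .{{_ : NonZero b}} → m ℕ.* b ≡ n ℕ.* a → m /ℕ a ≡ n /ℕ b
/ℕ-cross-≡ {m} {n} {suc a} {suc b} eq = ℚP.fromℚᵘ-cong {mkℚᵘ (+ m) a} {mkℚᵘ (+ n) b}
  (*≡* (trans (sym (ℤP.pos-* m (suc b))) (trans (cong +_ eq) (ℤP.pos-* n (suc a)))))

/ℕ-cross-≤ : ∀ {m n a b} .{{_ : NonZero a}} .{{_ : NonZero b}} → m ℕ.* b ℕ.≤ n ℕ.* a → m /ℕ a ℚ.≤ n /ℕ b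
/ℕ-cross-≤ {m} {n} {suc a} {suc b} le = ℚP.toℚᵘ-cancel-≤
  (ℚᵘP.≤-respʳ-≃ (ℚᵘP.≃-sym (toℚᵘ-/ℕ n b)) (ℚᵘP.≤-respˡ-≃ (ℚᵘP.≃-sym (toℚᵘ-/ℕ m a))
    (*≤* (subst₂ ℤ._≤_ (ℤP.pos-* m (suc b)) (ℤP.pos-* n (suc a)) (ℤ.+≤+ le)))))

/ℕ-* : ∀ m n a b .{{_ : NonZero a}} .{{_ : NonZero b}} → (m /ℕ a) ℚ.* (n /ℕ b) ≡ (m ℕ.* n) /ℕ (a ℕ.* b)
/ℕ-* m n (suc a) (suc b) = ℚP.toℚᵘ-injective (begin
  ℚ.toℚᵘ ((m /ℕ suc a) ℚ.* (n /ℕ suc b))            ≈⟨ ℚP.toℚᵘ-homo-* (m /ℕ suc a) (n /ℕ suc b) ⟩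
  ℚ.toℚᵘ (m /ℕ suc a) ℚᵘ.* ℚ.toℚᵘ (n /ℕ suc b)      ≈⟨ ℚᵘP.*-cong (toℚᵘ-/ℕ m a) (toℚᵘ-/ℕ n b) ⟩
  mkℚᵘ (+ m ℤ.* + n) (ℕ.pred (suc a ℕ.* suc b))     ≡⟨ cong (λ p → mkℚᵘ p _) (sym (ℤP.pos-* m n)) ⟩
  mkℚᵘ (+ (m ℕ.* n)) (ℕ.pred (suc a ℕ.* suc b))     ≈⟨ ℚᵘP.≃-sym (toℚᵘ-/ℕ (m ℕ.* n) _) ⟩
  ℚ.toℚᵘ ((m ℕ.* n) /ℕ (suc a ℕ.* suc b))           ∎)
  where open ℚᵘP.≃-Reasoning

/ℕ-+ : ∀ m n a b .{{_ : NonZero a}} .{{_ : NonZero b}} → (m /ℕ a) ℚ.+ (n /ℕ b) ≡ (m ℕ.* b ℕ.+ n ℕ.* a) /ℕ (a ℕ.* b)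
/ℕ-+ m n (suc a) (suc b) = ℚP.toℚᵘ-injective (begin
  ℚ.toℚᵘ ((m /ℕ suc a) ℚ.+ (n /ℕ suc b))                               ≈⟨ ℚP.toℚᵘ-homo-+ (m /ℕ suc a) (n /ℕ suc b) ⟩
  ℚ.toℚᵘ (m /ℕ suc a) ℚᵘ.+ ℚ.toℚᵘ (n /ℕ suc b)                         ≈⟨ ℚᵘP.+-cong (toℚᵘ-/ℕ m a) (toℚᵘ-/ℕ n b) ⟩
  mkℚᵘ (+ m ℤ.* + suc b ℤ.+ + n ℤ.* + suc a) (ℕ.pred (suc a ℕ.* suc b)) ≡⟨ cong (λ p → mkℚᵘ p _) numerator ⟩
  mkℚᵘ (+ (m ℕ.* suc b ℕ.+ n ℕ.* suc a)) (ℕ.pred (suc a ℕ.* suc b))     ≈⟨ ℚᵘP.≃-sym (toℚᵘ-/ℕ _ _) ⟩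
  ℚ.toℚᵘ ((m ℕ.* suc b ℕ.+ n ℕ.* suc a) /ℕ (suc a ℕ.* suc b))           ∎)
  where
  open ℚᵘP.≃-Reasoning
  numerator : + m ℤ.* + suc b ℤ.+ + n ℤ.* + suc a ≡ + (m ℕ.* suc b ℕ.+ n ℕ.* suc a)
  numerator = trans (cong₂ ℤ._+_ (sym (ℤP.pos-* m (suc b))) (sym (ℤP.pos-* n (suc a))))
                    (sym (ℤP.pos-+ (m ℕ.* suc b) (n ℕ.* suc a)))

/ℕ-nonNeg : ∀ m n .{{_ : NonZero n}} → 0ℚ ℚ.≤ m /ℕ n
/ℕ-nonNeg m n = /ℕ-cross-≤ {0} {m} {1} {n} ℕ.z≤n

/ℕ-self : ∀ n .{{_ : NonZero n}} → n /ℕ n ≡ 1ℚ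
/ℕ-self n = /ℕ-cross-≡ {n} {1} {n} {1} (ℕP.*-comm n 1)

/ℕ-complement : ∀ n → n /ℕ suc n ≡ 1ℚ ℚ.- 1 /ℕ suc n
/ℕ-complement n = begin
  n /ℕ suc n                                  ≡⟨ add-sub (n /ℕ suc n) (1 /ℕ suc n) ⟩
  (n /ℕ suc n ℚ.+ 1 /ℕ suc n) ℚ.- 1 /ℕ suc n  ≡⟨ cong (ℚ._- 1 /ℕ suc n) sum≡1 ⟩
  1ℚ ℚ.- 1 /ℕ suc n                           ∎
  where
  open ≡-Reasoning
  add-sub : ∀ x u → x ≡ (x ℚ.+ u) ℚ.- u
  add-sub = solve 2 (λ x u → x := (x :+ u) :- u) refl
    where open +-*-Solver
  sum≡1 : n /ℕ suc n ℚ.+ 1 /ℕ suc n ≡ 1ℚ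
  sum≡1 = trans (/ℕ-+ n 1 (suc n) (suc n))
    (/ℕ-cross-≡ {n ℕ.* suc n ℕ.+ 1 ℕ.* suc n} {1} {suc n ℕ.* suc n} {1} (cross n))
    where
    cross : ∀ n → (n ℕ.* suc n ℕ.+ 1 ℕ.* suc n) ℕ.* 1 ≡ 1 ℕ.* (suc n ℕ.* suc n)
    cross = solve-∀

fromℕ : ℕ → ℚ
fromℕ n = n /ℕ 1

fromℕ-+ : ∀ m n → fromℕ (m ℕ.+ n) ≡ fromℕ m ℚ.+ fromℕ n
fromℕ-+ m n = sym (trans (/ℕ-+ m n 1 1) (/ℕ-cross-≡ {m ℕ.* 1 ℕ.+ n ℕ.* 1} {m ℕ.+ n} {1} {1} (eq m n)))
  where
  eq : ∀ m n → (m ℕ.* 1 ℕ.+ n ℕ.* 1) ℕ.* 1 ≡ (m ℕ.+ n) ℕ.* 1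
  eq = solve-∀

fromℕ-*-1/ℕ : ∀ m n .{{_ : NonZero n}} → fromℕ m ℚ.* (1 /ℕ n) ≡ m /ℕ n
fromℕ-*-1/ℕ m n = trans (/ℕ-* m 1 1 n) (/ℕ-cross-≡ {m ℕ.* 1} {m} {1 ℕ.* n} {n} {{ℕP.m*n≢0 1 n}} (eq m n))
  where
  eq : ∀ m n → m ℕ.* 1 ℕ.* n ≡ m ℕ.* (1 ℕ.* n)
  eq = solve-∀

fromℕ-2^suc : ∀ n → fromℕ (2 ^ suc n) ≡ fromℕ (2 ^ n) ℚ.+ fromℕ (2 ^ n)
fromℕ-2^suc n = trans (cong (λ m → fromℕ (2 ^ n ℕ.+ m)) (ℕP.+-identityʳ (2 ^ n))) (fromℕ-+ (2 ^ n) (2 ^ n))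

indicatorℕ : Bool → ℕ
indicatorℕ true = 1
indicatorℕ false = 0

xor-≡ : ∀ {x y} → x ≡ y → x xor y ≡ false
xor-≡ {x} refl = BoolP.xor-same x

xor-≢ : ∀ {x y} → x ≢ y → x xor y ≡ true
xor-≢ {true} {true} x≢y = ⊥-elim (x≢y refl)
xor-≢ {true} {false} _ = refl
xor-≢ {false} {true} _ = refl
xor-≢ {false} {false} x≢y = ⊥-elim (x≢y refl)

xor≡false⇒≡ : ∀ {x y} → x xor y ≡ false → x ≡ y
xor≡false⇒≡ {true} {true} _ = refl
xor≡false⇒≡ {false} {false} _ = refl

xor≡true⇒≡not : ∀ {x y} → x xor y ≡ true → x ≡ not y
xor≡true⇒≡not {true} {false} _ = refl
xor≡true⇒≡not {false} {true} _ = refl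

all-++ : ∀ {A : Set} (p : A → Bool) xs ys → all p (xs ++ ys) ≡ all p xs ∧ all p ys
all-++ p [] ys = refl
all-++ p (x ∷ xs) ys = trans (cong (p x ∧_) (all-++ p xs ys)) (sym (BoolP.∧-assoc (p x) (all p xs) (all p ys)))

all-true : ∀ {A : Set} (p : A → Bool) (xs : List A) → (∀ {x} → x ∈ xs → p x ≡ true) → all p xs ≡ true
all-true p [] _ = refl
all-true p (x ∷ xs) p≡true rewrite p≡true (here refl) = all-true p xs (p≡true ∘ there)

any-false : ∀ {A : Set} (p : A → Bool) xs → (∀ x → p x ≡ false) → any p xs ≡ false
any-false p [] _ = refl
any-false p (x ∷ xs) p≡false rewrite p≡false x = any-false p xs p≡false

any-true : ∀ {A : Set} (p : A → Bool) {x} xs → x ∈ xs → p x ≡ true → any p xs ≡ true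
any-true p (y ∷ xs) (here refl) px≡true rewrite px≡true = refl
any-true p (y ∷ xs) (there x∈) px≡true = trans (cong (p y ∨_) (any-true p xs x∈ px≡true)) (BoolP.∨-zeroʳ (p y))

indicator-∧ : ∀ b c → indicator (b ∧ c) ≡ indicator b ℚ.* indicator c
indicator-∧ true c = sym (ℚP.*-identityˡ (indicator c))
indicator-∧ false c = sym (ℚP.*-zeroˡ (indicator c))

ℚsum-++ : ∀ xs ys → ℚsum (xs ++ ys) ≡ ℚsum xs ℚ.+ ℚsum ys
ℚsum-++ [] ys = sym (ℚP.+-identityˡ (ℚsum ys))
ℚsum-++ (x ∷ xs) ys = trans (cong (x ℚ.+_) (ℚsum-++ xs ys)) (sym (ℚP.+-assoc x (ℚsum xs) (ℚsum ys)))

module _ {A : Set} where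

  ℚsum-map-*ˡ : ∀ c (f : A → ℚ) xs → ℚsum (map (λ x → c ℚ.* f x) xs) ≡ c ℚ.* ℚsum (map f xs)
  ℚsum-map-*ˡ c f [] = sym (ℚP.*-zeroʳ c)
  ℚsum-map-*ˡ c f (x ∷ xs) =
    trans (cong (c ℚ.* f x ℚ.+_) (ℚsum-map-*ˡ c f xs)) (sym (ℚP.*-distribˡ-+ c (f x) (ℚsum (map f xs))))

  ℚsum-map-indicator : ∀ (b : A → Bool) xs → ℚsum (map (indicator ∘ b) xs) ≡ fromℕ (sum (map (indicatorℕ ∘ b) xs))
  ℚsum-map-indicator b [] = refl
  ℚsum-map-indicator b (x ∷ xs) =
    trans (cong₂ ℚ._+_ (indicator≡fromℕ (b x)) (ℚsum-map-indicator b xs)) (sym (fromℕ-+ (indicatorℕ (b x)) _))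
    where
    indicator≡fromℕ : ∀ c → indicator c ≡ fromℕ (indicatorℕ c)
    indicator≡fromℕ true = refl
    indicator≡fromℕ false = refl

  avg-cong : ∀ (xs : List A) {f g : A → ℚ} → (∀ x → f x ≡ g x) → avg xs f ≡ avg xs g
  avg-cong xs f≗g = cong (λ t → ℚsum t ℚ.* (1 /ℕ length xs)) (ListP.map-cong f≗g xs)

  avg-*ˡ : ∀ (xs : List A) c (f : A → ℚ) → avg xs (λ x → c ℚ.* f x) ≡ c ℚ.* avg xs f
  avg-*ˡ xs c f = trans (cong (ℚ._* (1 /ℕ length xs)) (ℚsum-map-*ˡ c f xs)) (ℚP.*-assoc c _ _)

  avg-*ʳ : ∀ (xs : List A) c (f : A → ℚ) → avg xs (λ x → f x ℚ.* c) ≡ avg xs f ℚ.* c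
  avg-*ʳ xs c f = trans (avg-cong xs (λ x → ℚP.*-comm (f x) c)) (trans (avg-*ˡ xs c f) (ℚP.*-comm c (avg xs f)))

avg-all-++ : ∀ {A : Set} (p : A → Bool) (xss yss : List (List A)) →
  avg xss (λ xs → avg yss (λ ys → indicator (all p (xs ++ ys))))
    ≡ avg xss (indicator ∘ all p) ℚ.* avg yss (indicator ∘ all p)
avg-all-++ p xss yss = begin
  avg xss (λ xs → avg yss (λ ys → indicator (all p (xs ++ ys))))
    ≡⟨ avg-cong xss (λ xs → avg-cong yss (λ ys → trans (cong indicator (all-++ p xs ys)) (indicator-∧ (all p xs) (all p ys)))) ⟩
  avg xss (λ xs → avg yss (λ ys → indicator (all p xs) ℚ.* indicator (all p ys)))
    ≡⟨ avg-cong xss (λ xs → avg-*ˡ yss (indicator (all p xs)) (indicator ∘ all p)) ⟩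
  avg xss (λ xs → indicator (all p xs) ℚ.* avg yss (indicator ∘ all p))
    ≡⟨ avg-*ʳ xss (avg yss (indicator ∘ all p)) (indicator ∘ all p) ⟩
  avg xss (indicator ∘ all p) ℚ.* avg yss (indicator ∘ all p)  ∎
  where open ≡-Reasoning

ℚsum-applyUpTo : ∀ (f : ℕ → ℚ) (g : ℕ → ℕ) n → ℚsum (map f (applyUpTo g n)) ≡ ∑[ j < n ] f (g (toℕ j))
ℚsum-applyUpTo f g zero = refl
ℚsum-applyUpTo f g (suc n) = cong (f (g 0) ℚ.+_) (ℚsum-applyUpTo f (g ∘ suc) n)

∑-mono-≤ : ∀ {n} {f g : Fin n → ℚ} → (∀ i → f i ℚ.≤ g i) → ∑[ i < n ] f i ℚ.≤ ∑[ i < n ] g i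
∑-mono-≤ {zero} _ = ℚP.≤-refl
∑-mono-≤ {suc n} f≤g = ℚP.+-mono-≤ (f≤g Fin.zero) (∑-mono-≤ (f≤g ∘ Fin.suc))

sum-map-cong-∈ : ∀ {A : Set} {f g : A → ℕ} (xs : List A) → (∀ {x} → x ∈ xs → f x ≡ g x) → sum (map f xs) ≡ sum (map g xs)
sum-map-cong-∈ [] _ = refl
sum-map-cong-∈ (x ∷ xs) f≡g = cong₂ ℕ._+_ (f≡g (here refl)) (sum-map-cong-∈ xs (f≡g ∘ there))

sum-map-1 : ∀ {A : Set} (xs : List A) → sum (map (λ _ → 1) xs) ≡ length xs
sum-map-1 [] = refl
sum-map-1 (x ∷ xs) = cong suc (sum-map-1 xs)

sum-map-0 : ∀ {A : Set} (xs : List A) → sum (map (λ _ → 0) xs) ≡ 0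
sum-map-0 [] = refl
sum-map-0 (x ∷ xs) = sum-map-0 xs

sum-map-concatMap-tabulate : ∀ {A B : Set} {n} (f : A → ℕ) (G : B → List A) (g : Fin n → B) →
  sum (map f (concatMap G (tabulate g))) ≡ ℕΣ.sum (λ i → sum (map f (G (g i))))
sum-map-concatMap-tabulate {n = zero} f G g = refl
sum-map-concatMap-tabulate {n = suc n} f G g = begin
  sum (map f (G (g zero) ++ rest))          ≡⟨ cong sum (ListP.map-++ f (G (g zero)) rest) ⟩
  sum (map f (G (g zero)) ++ map f rest)    ≡⟨ sum-++ (map f (G (g zero))) (map f rest) ⟩
  sum (map f (G (g zero))) ℕ.+ sum (map f rest)
    ≡⟨ cong (sum (map f (G (g zero))) ℕ.+_) (sum-map-concatMap-tabulate f G (g ∘ suc)) ⟩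
  ℕΣ.sum (λ i → sum (map f (G (g i))))      ∎
  where
  open ≡-Reasoning
  rest = concatMap G (tabulate (g ∘ suc))

unique∧set⇒↭ : ∀ {A : Set} {xs ys : List A} → Unique xs → Unique ys →
  (∀ {x} → x ∈ xs → x ∈ ys) → (∀ {x} → x ∈ ys → x ∈ xs) → xs ↭ ys
unique∧set⇒↭ xs! ys! xs⊆ys ys⊆xs = ∼bag⇒↭ (unique∧set⇒bag xs! ys! (mk⇔ xs⊆ys ys⊆xs))

-- Hamming distance and betweenness

differs : ∀ {k} → Assignment k → Assignment k → Fin k → ℕ
differs α β i = indicatorℕ (lookup α i xor lookup β i)

dist : ∀ {k} → Assignment k → Assignment k → ℕ
dist α β = ℕΣ.sum (differs α β)

lookup-ext : ∀ {k} {α β : Assignment k} → (∀ i → lookup α i ≡ lookup β i) → α ≡ β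
lookup-ext {α = α} {β} eq = trans (sym (VecP.tabulate∘lookup α)) (trans (VecP.tabulate-cong eq) (VecP.tabulate∘lookup β))

dist-self : ∀ {k} (α : Assignment k) → dist α α ≡ 0
dist-self {k} α = trans (ℕΣ.sum-cong-≗ (λ i → cong indicatorℕ (BoolP.xor-same (lookup α i)))) (ℕΣ.sum-replicate-zero k)

dist-sym : ∀ {k} (α β : Assignment k) → dist α β ≡ dist β α
dist-sym α β = ℕΣ.sum-cong-≗ (λ i → cong indicatorℕ (BoolP.xor-comm (lookup α i) (lookup β i)))

dist≡0⇒≡ : ∀ {k} (α β : Assignment k) → dist α β ≡ 0 → α ≡ β
dist≡0⇒≡ [] [] _ = refl
dist≡0⇒≡ (x ∷ α) (y ∷ β) d≡0 =
  cong₂ _∷_ (xor≡false (ℕP.m+n≡0⇒m≡0 _ d≡0)) (dist≡0⇒≡ α β (ℕP.m+n≡0⇒n≡0 _ d≡0))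
  where
  xor≡false : ∀ {x y} → indicatorℕ (x xor y) ≡ 0 → x ≡ y
  xor≡false {true} {true} _ = refl
  xor≡false {false} {false} _ = refl

dist-flip-agree : ∀ {k} (α β : Assignment k) i → lookup α i ≡ lookup β i → dist (α [ i ]%= not) β ≡ suc (dist α β)
dist-flip-agree (true ∷ α) (true ∷ β) zero refl = refl
dist-flip-agree (false ∷ α) (false ∷ β) zero refl = refl
dist-flip-agree (x ∷ α) (y ∷ β) (suc i) eq =
  trans (cong (indicatorℕ (x xor y) ℕ.+_) (dist-flip-agree α β i eq)) (ℕP.+-suc _ _)

dist-flip-differ : ∀ {k} (α β : Assignment k) i → lookup α i ≢ lookup β i → dist α β ≡ suc (dist (α [ i ]%= not) β)
dist-flip-differ (true ∷ α) (true ∷ β) zero ne = ⊥-elim (ne refl)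
dist-flip-differ (true ∷ α) (false ∷ β) zero ne = refl
dist-flip-differ (false ∷ α) (true ∷ β) zero ne = refl
dist-flip-differ (false ∷ α) (false ∷ β) zero ne = ⊥-elim (ne refl)
dist-flip-differ (x ∷ α) (y ∷ β) (suc i) ne =
  trans (cong (indicatorℕ (x xor y) ℕ.+_) (dist-flip-differ α β i ne)) (ℕP.+-suc _ _)

neighbour-dist : ∀ {k} (z : Assignment k) a → dist (z [ a ]%= not) z ≡ 1
neighbour-dist z a = trans (dist-flip-agree z z a refl) (cong suc (dist-self z))

∑-over-differing : ∀ {k} (α β : Assignment k) (f : Fin k → ℕ) c →
  (∀ i → lookup α i ≢ lookup β i → f i ≡ c) →
  ℕΣ.sum (λ i → differs α β i ℕ.* f i) ≡ dist α β ℕ.* c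
∑-over-differing α β f c f≡c = trans (ℕΣ.sum-cong-≗ pointwise) (sym (ℕΣ.*-distribʳ-sum c (λ i → differs α β i)))
  where
  pointwise : ∀ i → differs α β i ℕ.* f i ≡ differs α β i ℕ.* c
  pointwise i with lookup α i | lookup β i | f≡c i
  ... | true  | true  | _ = refl
  ... | true  | false | eq = cong (ℕ._+ 0) (eq (λ ()))
  ... | false | true  | eq = cong (ℕ._+ 0) (eq (λ ()))
  ... | false | false | _ = refl

flip-≢ : ∀ {k} (α : Assignment k) i → α ≢ α [ i ]%= not
flip-≢ α i eq = BoolP.not-¬ refl (trans (cong (λ γ → lookup γ i) eq) (VecP.lookup∘updateAt i α))

flip-injective : ∀ {k} (α : Assignment k) {i j} → α [ i ]%= not ≡ α [ j ]%= not → i ≡ j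
flip-injective α {i} {j} eq with i Fin.≟ j
... | yes i≡j = i≡j
... | no i≢j = ⊥-elim (BoolP.not-¬ refl (sym (begin
      not (lookup α i)             ≡⟨ VecP.lookup∘updateAt i α ⟨
      lookup (α [ i ]%= not) i     ≡⟨ cong (λ γ → lookup γ i) eq ⟩
      lookup (α [ j ]%= not) i     ≡⟨ VecP.lookup∘updateAt′ i j i≢j α ⟩
      lookup α i                   ∎)))
  where open ≡-Reasoning

record Between {k} (γ α β : Assignment k) : Set where
  constructor between
  field
    coordinate : ∀ i → lookup γ i ≡ lookup α i ⊎ lookup γ i ≡ lookup β i
open Between

between-self : ∀ {k} {γ α : Assignment k} → Between γ α α → γ ≡ α
between-self γ-between = lookup-ext (λ i → [ id , id ]′ (coordinate γ-between i))

between-sym : ∀ {k} {γ α β : Assignment k} → Between γ α β → Between γ β α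
between-sym γ-between = between λ i → [ inj₂ , inj₁ ]′ (coordinate γ-between i)

between-agree : ∀ {k} {γ α β : Assignment k} {i} → Between γ α β → lookup α i ≡ lookup β i → lookup α i ≡ lookup γ i
between-agree {i = i} γ-between αᵢ≡βᵢ = sym ([ id , (λ γᵢ≡βᵢ → trans γᵢ≡βᵢ (sym αᵢ≡βᵢ)) ]′ (coordinate γ-between i))

flip-between : ∀ {k} {α β : Assignment k} {i} → lookup α i ≢ lookup β i → Between (α [ i ]%= not) α β
flip-between {α = α} {β} {i} αᵢ≢βᵢ = between λ j → case j Fin.≟ i of λ where
  (yes refl) → inj₂ (trans (VecP.lookup∘updateAt j α) (sym (BoolP.¬-not (αᵢ≢βᵢ ∘ sym))))
  (no j≢i) → inj₁ (VecP.lookup∘updateAt′ j i j≢i α)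

flip-between-keeps : ∀ {k} {γ α β : Assignment k} {i} → Between γ α β → lookup α i ≢ lookup γ i →
  Between γ (α [ i ]%= not) β
flip-between-keeps {γ = γ} {α} {β} {i} γ-between αᵢ≢γᵢ = between λ j → case j Fin.≟ i of λ where
  (yes refl) → inj₂ ([ (λ γᵢ≡αᵢ → ⊥-elim (αᵢ≢γᵢ (sym γᵢ≡αᵢ))) , id ]′ (coordinate γ-between j))
  (no j≢i) → [ (λ γⱼ≡αⱼ → inj₁ (trans γⱼ≡αⱼ (sym (VecP.lookup∘updateAt′ j i j≢i α)))) , inj₂ ]′ (coordinate γ-between j)

flip-between-breaks : ∀ {k} {γ α β : Assignment k} {i} → lookup α i ≡ lookup γ i → lookup α i ≢ lookup β i →
  ¬ Between γ (α [ i ]%= not) β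
flip-between-breaks {γ = γ} {α} {β} {i} αᵢ≡γᵢ αᵢ≢βᵢ γ-between with coordinate γ-between i
... | inj₁ γᵢ≡flipᵢ = BoolP.not-¬ refl (trans αᵢ≡γᵢ (trans γᵢ≡flipᵢ (VecP.lookup∘updateAt i α)))
... | inj₂ γᵢ≡βᵢ = αᵢ≢βᵢ (trans αᵢ≡γᵢ γᵢ≡βᵢ)

neighbour-between : ∀ {k} {z γ : Assignment k} {a} → lookup γ a ≡ lookup z a → Between z (z [ a ]%= not) γ
neighbour-between {z = z} {a = a} γₐ≡zₐ = between λ j → case j Fin.≟ a of λ where
  (yes refl) → inj₂ (sym γₐ≡zₐ)
  (no j≢a) → inj₁ (sym (VecP.lookup∘updateAt′ j a j≢a z))

-- Irredundant reconfiguration sequences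

-- The last component of Irredundant.
SwitchTimes : ∀ {k} → Assignment k → Assignment k → List (Assignment k) → Set
SwitchTimes {k} α β s = ∀ (i : Fin k) → ∃[ tᵢ ]
  (∀ (t : Fin (length s)) →
     (toℕ t ℕ.< tᵢ → lookup (List.lookup s t) i ≡ lookup α i)
   × (tᵢ ℕ.≤ toℕ t → lookup (List.lookup s t) i ≡ lookup β i))

switchTimes-between : ∀ {k} {α β : Assignment k} {s} → SwitchTimes α β s → ∀ t → Between (List.lookup s t) α β
switchTimes-between st t = between λ i → case st i of λ where
  (tᵢ , at) → case toℕ t ℕP.<? tᵢ of λ where
    (yes before) → inj₁ (proj₁ (at t) before)
    (no after) → inj₂ (proj₂ (at t) (ℕP.≮⇒≥ after))

irredundant-between : ∀ {k} {α β γ : Assignment k} {s} → Irredundant α β s → γ ∈ s → Between γ α β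
irredundant-between {α = α} {β} {s = s} (_ , _ , st) γ∈s rewrite lookup-index γ∈s =
  switchTimes-between {α = α} {β} {s} st (index γ∈s)

switchTimes-tail : ∀ {k} {α β x y : Assignment k} {s} → SwitchTimes α β (x ∷ y ∷ s) → SwitchTimes y β (y ∷ s)
switchTimes-tail st i with st i
... | 0 , at = 0 , λ t → (λ ()) , λ _ → proj₂ (at (suc t)) z≤n
... | 1 , at = 0 , λ t → (λ ()) , λ _ → proj₂ (at (suc t)) (s≤s z≤n)
... | suc (suc tᵢ) , at = suc tᵢ , λ t →
      (λ t<tᵢ → trans (proj₁ (at (suc t)) (s≤s t<tᵢ)) (sym y≡α)) , λ tᵢ≤t → proj₂ (at (suc t)) (s≤s tᵢ≤t)
  where
  y≡α = proj₁ (at (suc zero)) (s≤s (s≤s z≤n))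

switchTimes-∷ : ∀ {k} {α β γ : Assignment k} {s} → Between γ α β → SwitchTimes γ β s → SwitchTimes α β (α ∷ s)
switchTimes-∷ {α = α} {β} {γ} {s} γ-between st i with st i | coordinate γ-between i
... | tᵢ , at | inj₁ γ≡α = suc tᵢ , λ where
  zero → (λ _ → refl) , λ ()
  (suc t) → (λ { (s≤s t<tᵢ) → trans (proj₁ (at t) t<tᵢ) γ≡α }) , λ { (s≤s tᵢ≤t) → proj₂ (at t) tᵢ≤t }
... | tᵢ , at | inj₂ γ≡β = 1 , λ where
  zero → (λ _ → refl) , λ ()
  (suc t) → (λ { (s≤s ()) }) , λ _ →
    [ (λ s[t]≡γ → trans s[t]≡γ γ≡β) , id ]′ (coordinate (switchTimes-between {α = γ} {β} {s} st t) i)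

irredundant-∷ : ∀ {k} {α β : Assignment k} {i} {s} → lookup α i ≢ lookup β i →
  Irredundant (α [ i ]%= not) β s → Irredundant α β (α ∷ s)
irredundant-∷ {s = []} _ ((() , _) , _)
irredundant-∷ {α = α} {β} {i} {y ∷ s} αᵢ≢βᵢ ((refl , last≡β , steps) , distinct , st) =
  (refl , last≡β , (i , λ j j≢i → sym (VecP.lookup∘updateAt′ j i j≢i α)) ∷ steps) ,
  flip-≢ α i ∷ distinct ,
  switchTimes-∷ {α = α} {β} {α [ i ]%= not} {y ∷ s} (flip-between {α = α} {β} {i} αᵢ≢βᵢ) st

irredundant-[_] : ∀ {k} (α : Assignment k) → Irredundant α α (α ∷ [])
irredundant-[ α ] = (refl , refl , [-]) , [-] , λ i → 0 , λ where
  zero → (λ ()) , λ _ → refl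

irredundant-refl : ∀ {k} {α : Assignment k} {s} → Irredundant α α s → s ≡ α ∷ []
irredundant-refl {s = []} ((() , _) , _)
irredundant-refl {s = x ∷ []} ((head≡α , _) , _) = cong (_∷ []) (MaybeP.just-injective head≡α)
irredundant-refl {s = x ∷ y ∷ _} ir@((refl , _) , x≢y ∷ _ , _) =
  ⊥-elim (x≢y (sym (lookup-ext (λ i → [ id , id ]′ (coordinate (irredundant-between ir (there (here refl))) i)))))

irredundant-uncons : ∀ {k} {α β : Assignment k} {s} → α ≢ β → Irredundant α β s →
  ∃[ i ] ∃[ s′ ] (s ≡ α ∷ s′ × lookup α i ≢ lookup β i × Irredundant (α [ i ]%= not) β s′)
irredundant-uncons {s = []} _ ((() , _) , _)
irredundant-uncons {s = x ∷ []} α≢β ((head≡α , last≡β , _) , _) =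
  ⊥-elim (α≢β (trans (sym (MaybeP.just-injective head≡α)) (MaybeP.just-injective last≡β)))
irredundant-uncons {α = α} {β} {s = x ∷ y ∷ s} α≢β ir@((refl , last≡β , (i , agree) ∷ steps) , α≢y ∷ distinct , st) =
  i , y ∷ s , refl , αᵢ≢βᵢ ,
  subst (λ γ → Irredundant γ β (y ∷ s)) y≡flip
        ((refl , last≡β , steps) , distinct , switchTimes-tail {α = α} {β} {α} {y} {s} st)
  where
  yᵢ≢αᵢ : lookup y i ≢ lookup α i
  yᵢ≢αᵢ yᵢ≡αᵢ = α≢y (lookup-ext λ j → case j Fin.≟ i of λ where
    (yes refl) → sym yᵢ≡αᵢ
    (no j≢i) → agree j j≢i)
  yᵢ≡βᵢ : lookup y i ≡ lookup β i
  yᵢ≡βᵢ = [ (λ yᵢ≡αᵢ → ⊥-elim (yᵢ≢αᵢ yᵢ≡αᵢ)) , id ]′ (coordinate (irredundant-between ir (there (here refl))) i)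
  αᵢ≢βᵢ : lookup α i ≢ lookup β i
  αᵢ≢βᵢ αᵢ≡βᵢ = yᵢ≢αᵢ (trans yᵢ≡βᵢ (sym αᵢ≡βᵢ))
  y≡flip : y ≡ α [ i ]%= not
  y≡flip = lookup-ext λ j → case j Fin.≟ i of λ where
    (yes refl) → trans (BoolP.¬-not yᵢ≢αᵢ) (sym (VecP.lookup∘updateAt j α))
    (no j≢i) → trans (sym (agree j j≢i)) (sym (VecP.lookup∘updateAt′ j i j≢i α))

-- Counting irredundant sequences

-- pAvoid (lookup γ a xor lookup z a) (dist γ z) is the probability that a random irredundant
-- path between z [ a ]%= not and γ avoids z.
pAvoid : Bool → ℕ → ℚ
pAvoid true _ = 1ℚ
pAvoid false w = w /ℕ suc w

module Enumeration {k : ℕ} (E : Assignment k → Assignment k → List (List (Assignment k)))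
  (E-sound : ∀ α β s → s ∈ E α β → Irredundant α β s)
  (E-complete : ∀ α β s → Irredundant α β s → s ∈ E α β)
  (E-unique : ∀ α β → Unique (E α β)) where

  Seq : Set
  Seq = List (Assignment k)

  firstSteps : Assignment k → Assignment k → Fin k → List Seq
  firstSteps α β i with lookup α i Bool.≟ lookup β i
  ... | yes _ = []
  ... | no _ = map (α ∷_) (E (α [ i ]%= not) β)

  ∈-firstSteps : ∀ {α β i s} → s ∈ firstSteps α β i →
    ∃[ s′ ] (s ≡ α ∷ s′ × lookup α i ≢ lookup β i × s′ ∈ E (α [ i ]%= not) β)
  ∈-firstSteps {α} {β} {i} s∈ with lookup α i Bool.≟ lookup β i
  ... | no αᵢ≢βᵢ = let s′ , s′∈ , s≡ = ∈-map⁻ (α ∷_) s∈ in s′ , s≡ , αᵢ≢βᵢ , s′∈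

  firstSteps-disjoint : ∀ α β {i j} → i ≢ j → Disjoint (firstSteps α β i) (firstSteps α β j)
  firstSteps-disjoint α β {i} {j} i≢j (s∈ᵢ , s∈ⱼ)
    with ∈-firstSteps {α} {β} {i} s∈ᵢ | ∈-firstSteps {α} {β} {j} s∈ⱼ
  ... | sᵢ , refl , _ , sᵢ∈ | sⱼ , s≡ , _ , sⱼ∈ = i≢j (flip-injective α (MaybeP.just-injective (begin
    just (α [ i ]%= not)   ≡⟨ proj₁ (proj₁ (E-sound _ _ sᵢ sᵢ∈)) ⟨
    List.head sᵢ           ≡⟨ cong List.head (ListP.∷-injectiveʳ s≡) ⟩
    List.head sⱼ           ≡⟨ proj₁ (proj₁ (E-sound _ _ sⱼ sⱼ∈)) ⟩
    just (α [ j ]%= not)   ∎)))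
    where open ≡-Reasoning

  firstSteps-unique : ∀ α β i → Unique (firstSteps α β i)
  firstSteps-unique α β i with lookup α i Bool.≟ lookup β i
  ... | yes _ = []
  ... | no _ = UniqueP.map⁺ ListP.∷-injectiveʳ (E-unique _ _)

  E-↭-firstSteps : ∀ {α β} → α ≢ β → E α β ↭ concatMap (firstSteps α β) (allFin k)
  E-↭-firstSteps {α} {β} α≢β = unique∧set⇒↭ (E-unique α β) concat-unique E⊆ ⊆E
    where
    concat-unique : Unique (concatMap (firstSteps α β) (allFin k))
    concat-unique = UniqueP.concat⁺ (AllP.map⁺ (AllP.tabulate⁺ (firstSteps-unique α β)))
      (AllPairsP.map⁺ (AllPairs.map (firstSteps-disjoint α β) (UniqueP.allFin⁺ k)))
    E⊆ : ∀ {s} → s ∈ E α β → s ∈ concatMap (firstSteps α β) (allFin k)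
    E⊆ {s} s∈ with irredundant-uncons α≢β (E-sound α β s s∈)
    ... | i , s′ , refl , αᵢ≢βᵢ , ir = ∈-concatMap⁺ (firstSteps α β) (lose (∈-allFin i) step∈)
      where
      step∈ : α ∷ s′ ∈ firstSteps α β i
      step∈ with lookup α i Bool.≟ lookup β i
      ... | yes αᵢ≡βᵢ = ⊥-elim (αᵢ≢βᵢ αᵢ≡βᵢ)
      ... | no _ = ∈-map⁺ (α ∷_) (E-complete _ β s′ ir)
    ⊆E : ∀ {s} → s ∈ concatMap (firstSteps α β) (allFin k) → s ∈ E α β
    ⊆E {s} s∈ with satisfied (∈-concatMap⁻ (firstSteps α β) {xs = allFin k} s∈)
    ... | i , s∈ᵢ with ∈-firstSteps {α} {β} {i} s∈ᵢ
    ...   | s′ , refl , αᵢ≢βᵢ , s′∈ = E-complete α β s (irredundant-∷ αᵢ≢βᵢ (E-sound _ β s′ s′∈))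

  E-refl-↭ : ∀ α → E α α ↭ (α ∷ []) ∷ []
  E-refl-↭ α = unique∧set⇒↭ (E-unique α α) ([] ∷ [])
    (λ {s} s∈ → here (irredundant-refl (E-sound α α s s∈)))
    (λ { (here refl) → E-complete α α _ irredundant-[ α ] })

  sum-firstSteps : ∀ α β i (f : Seq → ℕ) → sum (map f (firstSteps α β i))
    ≡ differs α β i ℕ.* sum (map (f ∘ (α ∷_)) (E (α [ i ]%= not) β))
  sum-firstSteps α β i f with lookup α i Bool.≟ lookup β i
  ... | yes αᵢ≡βᵢ = sym (cong (λ b → indicatorℕ b ℕ.* sum (map (f ∘ (α ∷_)) (E (α [ i ]%= not) β))) (xor-≡ αᵢ≡βᵢ))
  ... | no αᵢ≢βᵢ = begin
    sum (map f (map (α ∷_) paths))      ≡⟨ cong sum (ListP.map-∘ paths) ⟨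
    sum (map (f ∘ (α ∷_)) paths)        ≡⟨ ℕP.*-identityˡ (sum (map (f ∘ (α ∷_)) paths)) ⟨
    1 ℕ.* sum (map (f ∘ (α ∷_)) paths)  ≡⟨ cong (λ b → indicatorℕ b ℕ.* sum (map (f ∘ (α ∷_)) paths)) (xor-≢ αᵢ≢βᵢ) ⟨
    differs α β i ℕ.* sum (map (f ∘ (α ∷_)) paths) ∎
    where
    open ≡-Reasoning
    paths = E (α [ i ]%= not) β

  sum-E-firstStep : ∀ {α β} → α ≢ β → (f : Seq → ℕ) → sum (map f (E α β))
    ≡ ℕΣ.sum (λ i → differs α β i ℕ.* sum (map (f ∘ (α ∷_)) (E (α [ i ]%= not) β)))
  sum-E-firstStep {α} {β} α≢β f = begin
    sum (map f (E α β))                                  ≡⟨ sum-↭ (PermP.map⁺ f (E-↭-firstSteps α≢β)) ⟩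
    sum (map f (concatMap (firstSteps α β) (allFin k)))  ≡⟨ sum-map-concatMap-tabulate f (firstSteps α β) id ⟩
    ℕΣ.sum (λ i → sum (map f (firstSteps α β i)))        ≡⟨ ℕΣ.sum-cong-≗ (λ i → sum-firstSteps α β i f) ⟩
    ℕΣ.sum (λ i → differs α β i ℕ.* sum (map (f ∘ (α ∷_)) (E (α [ i ]%= not) β))) ∎
    where open ≡-Reasoning

  sum-E-refl : ∀ α (f : Seq → ℕ) → sum (map f (E α α)) ≡ f (α ∷ []) ℕ.+ 0
  sum-E-refl α f = sum-↭ (PermP.map⁺ f (E-refl-↭ α))

  length-E : ∀ α β → length (E α β) ≡ dist α β !
  length-E α β = go (dist α β) refl
    where
    go : ∀ {α} d → dist α β ≡ d → length (E α β) ≡ d !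
    go {α} zero d≡0 with dist≡0⇒≡ α β d≡0
    ... | refl = trans (sym (sum-map-1 (E α α))) (sum-E-refl α (λ _ → 1))
    go {α} (suc d) d≡ = begin
      length (E α β)                                    ≡⟨ sum-map-1 (E α β) ⟨
      sum (map (λ _ → 1) (E α β))                       ≡⟨ sum-E-firstStep α≢β (λ _ → 1) ⟩
      ℕΣ.sum (λ i → differs α β i ℕ.* sum (map (λ _ → 1) (E (α [ i ]%= not) β)))
        ≡⟨ ∑-over-differing α β _ (d !) flip-count ⟩
      dist α β ℕ.* d !                                  ≡⟨ cong (ℕ._* d !) d≡ ⟩
      suc d !                                           ∎
      where
      open ≡-Reasoning
      α≢β : α ≢ β
      α≢β refl = ℕP.0≢1+n (trans (sym (dist-self α)) d≡)
      flip-count : ∀ i → lookup α i ≢ lookup β i → sum (map (λ _ → 1) (E (α [ i ]%= not) β)) ≡ d !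
      flip-count i αᵢ≢βᵢ = trans (sum-map-1 (E (α [ i ]%= not) β))
        (go d (ℕP.suc-injective (trans (sym (dist-flip-differ α β i αᵢ≢βᵢ)) d≡)))

  module Avoiding (z : Assignment k) (sat : Assignment k → Bool)
    (sat-z : sat z ≡ false) (sat-≢z : ∀ {γ} → γ ≢ z → sat γ ≡ true) where

    avoiding : Assignment k → Assignment k → ℕ
    avoiding α β = sum (map (indicatorℕ ∘ all sat) (E α β))

    avoiding-not-between : ∀ α β → ¬ Between z α β → avoiding α β ≡ dist α β !
    avoiding-not-between α β z-not-between = begin
      avoiding α β                  ≡⟨ sum-map-cong-∈ (E α β) (cong indicatorℕ ∘ all-sat) ⟩
      sum (map (λ _ → 1) (E α β))   ≡⟨ sum-map-1 (E α β) ⟩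
      length (E α β)                ≡⟨ length-E α β ⟩
      dist α β !                    ∎
      where
      open ≡-Reasoning
      all-sat : ∀ {s} → s ∈ E α β → all sat s ≡ true
      all-sat {s} s∈ = all-true sat s λ {γ} γ∈ →
        sat-≢z (λ { refl → z-not-between (irredundant-between (E-sound α β s s∈) γ∈) })

    avoiding-from-z : ∀ β → avoiding z β ≡ 0
    avoiding-from-z β = trans (sum-map-cong-∈ (E z β) (λ {s} s∈ → starts-at-z s (proj₁ (proj₁ (E-sound z β s s∈)))))
                              (sum-map-0 (E z β))
      where
      starts-at-z : ∀ s → List.head s ≡ just z → indicatorℕ (all sat s) ≡ 0
      starts-at-z (_ ∷ s) refl rewrite sat-z = refl

    avoiding-firstStep : ∀ {α β} → α ≢ z → α ≢ β →
      avoiding α β ≡ ℕΣ.sum (λ i → differs α β i ℕ.* avoiding (α [ i ]%= not) β)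
    avoiding-firstStep {α} {β} α≢z α≢β = trans (sum-E-firstStep α≢β (indicatorℕ ∘ all sat)) (ℕΣ.sum-cong-≗ λ i →
      cong (differs α β i ℕ.*_) (cong sum (ListP.map-cong (λ s → cong (λ b → indicatorℕ (b ∧ all sat s)) (sat-≢z α≢z))
                                                           (E (α [ i ]%= not) β))))

    -- After a first flip at a coordinate where α agrees with z, z no longer lies between the new
    -- start and β, so none of those paths meets z; every other first flip lowers dist α z by one.
    avoiding-first-flip : ∀ {α β D m} → Between z α β → dist α β ≡ suc m →
      (∀ i → lookup α i ≢ lookup β i → lookup α i ≢ lookup z i → avoiding (α [ i ]%= not) β ℕ.+ D ! ℕ.* dist z β ! ≡ m !) →
      ∀ i → differs α β i ℕ.* avoiding (α [ i ]%= not) β ℕ.+ differs α z i ℕ.* (D ! ℕ.* dist z β !) ≡ differs α β i ℕ.* m !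
    avoiding-first-flip {α} {β} {D} {m} z-between d≡ flip-count i
      with lookup α i Bool.≟ lookup β i | lookup α i Bool.≟ lookup z i
    ... | yes αᵢ≡βᵢ | _ rewrite xor-≡ αᵢ≡βᵢ | xor-≡ (between-agree {γ = z} {α} {β} {i} z-between αᵢ≡βᵢ) = refl
    ... | no αᵢ≢βᵢ | yes αᵢ≡zᵢ rewrite xor-≢ αᵢ≢βᵢ | xor-≡ αᵢ≡zᵢ = cong (ℕ._+ 0) (begin
      avoiding (α [ i ]%= not) β ℕ.+ 0   ≡⟨ ℕP.+-identityʳ _ ⟩
      avoiding (α [ i ]%= not) β
        ≡⟨ avoiding-not-between (α [ i ]%= not) β (flip-between-breaks {γ = z} {α} {β} {i} αᵢ≡zᵢ αᵢ≢βᵢ) ⟩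
      dist (α [ i ]%= not) β !           ≡⟨ cong _! (ℕP.suc-injective (trans (sym (dist-flip-differ α β i αᵢ≢βᵢ)) d≡)) ⟩
      m !                                ∎)
      where open ≡-Reasoning
    ... | no αᵢ≢βᵢ | no αᵢ≢zᵢ rewrite xor-≢ αᵢ≢βᵢ | xor-≢ αᵢ≢zᵢ =
      trans (cong₂ ℕ._+_ (ℕP.+-identityʳ (avoiding (α [ i ]%= not) β)) (ℕP.+-identityʳ (D ! ℕ.* dist z β !)))
            (trans (flip-count i αᵢ≢βᵢ αᵢ≢zᵢ) (sym (ℕP.+-identityʳ (m !))))

    avoiding-between : ∀ α β → Between z α β → avoiding α β ℕ.+ dist α z ! ℕ.* dist z β ! ≡ dist α β !
    avoiding-between α β = go (dist α z) refl
      where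
      e = dist z β !
      α≢z : ∀ {α D} → dist α z ≡ suc D → α ≢ z
      α≢z D≡ refl = ℕP.0≢1+n (trans (sym (dist-self z)) D≡)
      go : ∀ {α} D → dist α z ≡ D → Between z α β → avoiding α β ℕ.+ dist α z ! ℕ.* e ≡ dist α β !
      go {α} zero D≡0 _ with dist≡0⇒≡ α z D≡0
      ... | refl = begin
        avoiding z β ℕ.+ dist z z ! ℕ.* e   ≡⟨ cong₂ (λ a d → a ℕ.+ d ! ℕ.* e) (avoiding-from-z β) (dist-self z) ⟩
        e ℕ.+ 0                             ≡⟨ ℕP.+-identityʳ e ⟩
        e                                   ∎
        where open ≡-Reasoning
      go {α} (suc D) D≡ z-between with dist α β in d≡
      ... | zero = ⊥-elim (α≢z D≡ (sym (between-self (subst (Between z α) (sym (dist≡0⇒≡ α β d≡)) z-between))))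
      ... | suc m = begin
        avoiding α β ℕ.+ dist α z ! ℕ.* e
          ≡⟨ cong₂ ℕ._+_ (avoiding-firstStep (α≢z D≡) α≢β) z-term ⟩
        ℕΣ.sum (λ i → differs α β i ℕ.* avoiding (α [ i ]%= not) β) ℕ.+ dist α z ℕ.* c
          ≡⟨ cong (ℕΣ.sum (λ i → differs α β i ℕ.* avoiding (α [ i ]%= not) β) ℕ.+_)
                  (∑-over-differing α z (λ _ → c) c (λ _ _ → refl)) ⟨
        ℕΣ.sum (λ i → differs α β i ℕ.* avoiding (α [ i ]%= not) β) ℕ.+ ℕΣ.sum (λ i → differs α z i ℕ.* c)
          ≡⟨ ℕΣ.∑-distrib-+ (λ i → differs α β i ℕ.* avoiding (α [ i ]%= not) β) (λ i → differs α z i ℕ.* c) ⟨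
        ℕΣ.sum (λ i → differs α β i ℕ.* avoiding (α [ i ]%= not) β ℕ.+ differs α z i ℕ.* c)
          ≡⟨ ℕΣ.sum-cong-≗ (avoiding-first-flip {α} {β} {D} {m} z-between d≡ flip-count) ⟩
        ℕΣ.sum (λ i → differs α β i ℕ.* m !)
          ≡⟨ ∑-over-differing α β (λ _ → m !) (m !) (λ _ _ → refl) ⟩
        dist α β ℕ.* m !
          ≡⟨ cong (ℕ._* m !) d≡ ⟩
        suc m !
          ∎
        where
        open ≡-Reasoning
        c = D ! ℕ.* e
        α≢β : α ≢ β
        α≢β refl = ℕP.0≢1+n (trans (sym (dist-self α)) d≡)
        z-term : dist α z ! ℕ.* e ≡ dist α z ℕ.* c
        z-term = trans (cong (λ d → d ! ℕ.* e) D≡) (trans (ℕP.*-assoc (suc D) (D !) e) (cong (ℕ._* c) (sym D≡)))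
        flip-count : ∀ i → lookup α i ≢ lookup β i → lookup α i ≢ lookup z i → avoiding (α [ i ]%= not) β ℕ.+ c ≡ m !
        flip-count i αᵢ≢βᵢ αᵢ≢zᵢ = begin
          avoiding (α [ i ]%= not) β ℕ.+ D ! ℕ.* e
            ≡⟨ cong (λ d → avoiding (α [ i ]%= not) β ℕ.+ d ! ℕ.* e) flip-dist-z ⟨
          avoiding (α [ i ]%= not) β ℕ.+ dist (α [ i ]%= not) z ! ℕ.* e
            ≡⟨ go D flip-dist-z (flip-between-keeps {γ = z} {α} {β} {i} z-between αᵢ≢zᵢ) ⟩
          dist (α [ i ]%= not) β !
            ≡⟨ cong _! (ℕP.suc-injective (trans (sym (dist-flip-differ α β i αᵢ≢βᵢ)) d≡)) ⟩
          m !  ∎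
          where
          flip-dist-z : dist (α [ i ]%= not) z ≡ D
          flip-dist-z = ℕP.suc-injective (trans (sym (dist-flip-differ α z i αᵢ≢zᵢ)) D≡)

    Pr : Assignment k → Assignment k → ℚ
    Pr α β = avg (E α β) (indicator ∘ all sat)

    Pr≡avoiding/total : ∀ α β → Pr α β ≡ avoiding α β /ℕ (dist α β !)
    Pr≡avoiding/total α β = trans
      (cong₂ ℚ._*_ (ℚsum-map-indicator (all sat) (E α β)) (cong (1 /ℕ_) (length-E α β)))
      (fromℕ-*-1/ℕ (avoiding α β) (dist α β !) {{dist α β !≢0}})

    Pr-not-between : ∀ α β → ¬ Between z α β → Pr α β ≡ 1ℚ
    Pr-not-between α β z-not-between = begin
      Pr α β                           ≡⟨ Pr≡avoiding/total α β ⟩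
      avoiding α β /ℕ (dist α β !)       ≡⟨ cong (_/ℕ (dist α β !)) (avoiding-not-between α β z-not-between) ⟩
      (dist α β !) /ℕ (dist α β !)         ≡⟨ /ℕ-self (dist α β !) {{dist α β !≢0}} ⟩
      1ℚ                               ∎
      where open ≡-Reasoning

    Pr-between : ∀ α β w → Between z α β → dist α z ! ℕ.* dist z β ! ≡ w ! → dist α β ≡ suc w → Pr α β ≡ w /ℕ suc w
    Pr-between α β w z-between detours≡ d≡ = begin
      Pr α β                           ≡⟨ Pr≡avoiding/total α β ⟩
      avoiding α β /ℕ (dist α β !)       ≡⟨ cong₂ (λ a d → a /ℕ (d !)) avoiding≡ d≡ ⟩
      (w ℕ.* w !) /ℕ (suc w !)           ≡⟨ /ℕ-cross-≡ {w ℕ.* w !} {w} {suc w !} {suc w} {{suc w !≢0}} (cross w (w !)) ⟩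
      w /ℕ suc w                       ∎
      where
      open ≡-Reasoning
      avoiding≡ : avoiding α β ≡ w ℕ.* w !
      avoiding≡ = ℕP.+-cancelʳ-≡ (w !) _ _ (begin
        avoiding α β ℕ.+ w !                       ≡⟨ cong (avoiding α β ℕ.+_) detours≡ ⟨
        avoiding α β ℕ.+ dist α z ! ℕ.* dist z β ! ≡⟨ avoiding-between α β z-between ⟩
        dist α β !                                 ≡⟨ cong _! d≡ ⟩
        w ! ℕ.+ w ℕ.* w !                          ≡⟨ ℕP.+-comm (w !) (w ℕ.* w !) ⟩
        w ℕ.* w ! ℕ.+ w !                          ∎)
      cross : ∀ w f → w ℕ.* f ℕ.* suc w ≡ w ℕ.* (suc w ℕ.* f)
      cross = solve-∀

    Pr-from-neighbour : ∀ a γ → Pr (z [ a ]%= not) γ ≡ pAvoid (lookup γ a xor lookup z a) (dist γ z)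
    Pr-from-neighbour a γ with lookup γ a Bool.≟ lookup z a
    ... | yes γₐ≡zₐ rewrite xor-≡ γₐ≡zₐ =
      Pr-between (z [ a ]%= not) γ (dist γ z) (neighbour-between γₐ≡zₐ)
        (trans (cong (λ d → d ! ℕ.* dist z γ !) (neighbour-dist z a)) (trans (ℕP.+-identityʳ _) (cong _! (dist-sym z γ))))
        (trans (dist-flip-agree z γ a (sym γₐ≡zₐ)) (cong suc (dist-sym z γ)))
    ... | no γₐ≢zₐ rewrite xor-≢ γₐ≢zₐ =
      Pr-not-between (z [ a ]%= not) γ (flip-between-breaks {γ = z} {z} {γ} {a} refl (γₐ≢zₐ ∘ sym))

    Pr-to-neighbour : ∀ b γ → Pr γ (z [ b ]%= not) ≡ pAvoid (lookup γ b xor lookup z b) (dist γ z)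
    Pr-to-neighbour b γ with lookup γ b Bool.≟ lookup z b
    ... | yes γ_b≡z_b rewrite xor-≡ γ_b≡z_b =
      Pr-between γ (z [ b ]%= not) (dist γ z) (between-sym (neighbour-between γ_b≡z_b))
        (trans (cong (λ d → dist γ z ! ℕ.* d !) (trans (dist-sym z (z [ b ]%= not)) (neighbour-dist z b))) (ℕP.*-identityʳ _))
        (trans (dist-sym γ (z [ b ]%= not)) (trans (dist-flip-agree z γ b (sym γ_b≡z_b)) (cong suc (dist-sym z γ))))
    ... | no γ_b≢z_b rewrite xor-≢ γ_b≢z_b =
      Pr-not-between γ (z [ b ]%= not) (flip-between-breaks {γ = z} {z} {γ} {b} refl (γ_b≢z_b ∘ sym) ∘ between-sym)

-- The falsifying assignment of a clause

injective⇒surjective : ∀ {n} (f : Fin n → Fin n) → (∀ {i j} → f i ≡ f j → i ≡ j) → ∀ v → ∃ λ i → f i ≡ v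
injective⇒surjective {suc n} f f-injective v with FinP.any? (λ i → f i Fin.≟ v)
... | yes hit = hit
... | no miss = ⊥-elim (FinP.<⇒notInjective (ℕP.n<1+n n) punched-injective)
  where
  v≢f : ∀ i → v ≢ f i
  v≢f i v≡fi = miss (i , sym v≡fi)
  punched-injective : ∀ {i j} → punchOut (v≢f i) ≡ punchOut (v≢f j) → i ≡ j
  punched-injective eq = f-injective (FinP.punchOut-injective (v≢f _) (v≢f _) eq)

module Falsifier {k} (ℓ : Clause k) (distinct : ClauseDistinctVars ℓ) where

  var : Fin k → Fin k
  var i = proj₁ (ℓ i)

  literalOf : Fin k → Fin k
  literalOf v = proj₁ (injective⇒surjective var (distinct _ _) v)

  var-literalOf : ∀ v → var (literalOf v) ≡ v
  var-literalOf v = proj₂ (injective⇒surjective var (distinct _ _) v)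

  z : Assignment k
  z = Vec.tabulate (λ v → not (proj₂ (ℓ (literalOf v))))

  litVal≡xor : ∀ α i → litVal α (ℓ i) ≡ lookup α (var i) xor lookup z (var i)
  litVal≡xor α i
    rewrite VecP.lookup∘tabulate (λ v → not (proj₂ (ℓ (literalOf v)))) (var i)
          | distinct _ _ (var-literalOf (var i))
    with proj₂ (ℓ i) | lookup α (var i)
  ... | true  | true  = refl
  ... | true  | false = refl
  ... | false | true  = refl
  ... | false | false = refl

  satC-z : satC ℓ z ≡ false
  satC-z = any-false _ (allFin k) (λ i → trans (litVal≡xor z i) (BoolP.xor-same (lookup z (var i))))

  satC-≢z : ∀ {γ} → γ ≢ z → satC ℓ γ ≡ true
  satC-≢z {γ} γ≢z with FinP.¬∀⟶∃¬ k _ (λ v → lookup γ v Bool.≟ lookup z v) (γ≢z ∘ lookup-ext)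
  ... | v , γᵥ≢zᵥ = any-true _ (allFin k) (∈-allFin (literalOf v))
        (trans (litVal≡xor γ (literalOf v)) (subst (λ u → lookup γ u xor lookup z u ≡ true) (sym (var-literalOf v)) (xor-≢ γᵥ≢zᵥ)))

  exactlyOneTrue⇒neighbour : ∀ α → ExactlyOneTrue ℓ α → ∃[ a ] α ≡ z [ a ]%= not
  exactlyOneTrue⇒neighbour α (i , ℓᵢ-true , others-false) = var i , lookup-ext coordinate-eq
    where
    coordinate-eq : ∀ v → lookup α v ≡ lookup (z [ var i ]%= not) v
    coordinate-eq v with v Fin.≟ var i
    ... | yes refl = trans (xor≡true⇒≡not (trans (sym (litVal≡xor α i)) ℓᵢ-true)) (sym (VecP.lookup∘updateAt v z))
    ... | no v≢varᵢ = begin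
      lookup α v                      ≡⟨ cong (lookup α) (var-literalOf v) ⟨
      lookup α (var j)                ≡⟨ xor≡false⇒≡ (trans (sym (litVal≡xor α j)) (others-false j j≢i)) ⟩
      lookup z (var j)                ≡⟨ cong (lookup z) (var-literalOf v) ⟩
      lookup z v                      ≡⟨ VecP.lookup∘updateAt′ v (var i) v≢varᵢ z ⟨
      lookup (z [ var i ]%= not) v    ∎
      where
      open ≡-Reasoning
      j = literalOf v
      j≢i : j ≢ i
      j≢i refl = v≢varᵢ (sym (var-literalOf v))

-- Binomial sums over assignments

ℚsum-allAssign : ∀ n x (f : Assignment (suc n) → ℚ) → ℚsum (map f (allAssign (suc n)))
  ≡ ℚsum (map (f ∘ (x ∷_)) (allAssign n)) ℚ.+ ℚsum (map (f ∘ (not x ∷_)) (allAssign n))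
ℚsum-allAssign n true f = begin
  ℚsum (map f (map (true ∷_) (allAssign n) ++ map (false ∷_) (allAssign n)))
    ≡⟨ cong ℚsum (ListP.map-++ f (map (true ∷_) (allAssign n)) _) ⟩
  ℚsum (map f (map (true ∷_) (allAssign n)) ++ map f (map (false ∷_) (allAssign n)))
    ≡⟨ ℚsum-++ (map f (map (true ∷_) (allAssign n))) _ ⟩
  ℚsum (map f (map (true ∷_) (allAssign n))) ℚ.+ ℚsum (map f (map (false ∷_) (allAssign n)))
    ≡⟨ cong₂ (λ xs ys → ℚsum xs ℚ.+ ℚsum ys) (ListP.map-∘ (allAssign n)) (ListP.map-∘ (allAssign n)) ⟨
  ℚsum (map (f ∘ (true ∷_)) (allAssign n)) ℚ.+ ℚsum (map (f ∘ (false ∷_)) (allAssign n))  ∎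
  where open ≡-Reasoning
ℚsum-allAssign n false f =
  trans (ℚsum-allAssign n true f) (ℚP.+-comm (ℚsum (map (f ∘ (true ∷_)) (allAssign n))) (ℚsum (map (f ∘ (false ∷_)) (allAssign n))))

length-allAssign : ∀ n → List.length (allAssign n) ≡ 2 ^ n
length-allAssign zero = refl
length-allAssign (suc n) = begin
  List.length (map (true ∷_) (allAssign n) ++ map (false ∷_) (allAssign n))
    ≡⟨ ListP.length-++ (map (true ∷_) (allAssign n)) ⟩
  List.length (map (true ∷_) (allAssign n)) ℕ.+ List.length (map (false ∷_) (allAssign n))
    ≡⟨ cong₂ ℕ._+_ (ListP.length-map _ (allAssign n)) (ListP.length-map _ (allAssign n)) ⟩
  List.length (allAssign n) ℕ.+ List.length (allAssign n)
    ≡⟨ cong (λ m → m ℕ.+ m) (length-allAssign n) ⟩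
  2 ^ n ℕ.+ 2 ^ n
    ≡⟨ cong (2 ^ n ℕ.+_) (ℕP.+-identityʳ (2 ^ n)) ⟨
  2 ^ suc n ∎
  where open ≡-Reasoning

binomialSum : ℕ → (ℕ → ℚ) → ℚ
binomialSum zero φ = φ 0
binomialSum (suc n) φ = binomialSum n φ ℚ.+ binomialSum n (φ ∘ suc)

binomialSum-cong : ∀ n {φ ψ : ℕ → ℚ} → (∀ j → φ j ≡ ψ j) → binomialSum n φ ≡ binomialSum n ψ
binomialSum-cong zero φ≗ψ = φ≗ψ 0
binomialSum-cong (suc n) φ≗ψ = cong₂ ℚ._+_ (binomialSum-cong n φ≗ψ) (binomialSum-cong n (φ≗ψ ∘ suc))

binomialSum-+ : ∀ n (φ ψ : ℕ → ℚ) → binomialSum n φ ℚ.+ binomialSum n ψ ≡ binomialSum n (λ j → φ j ℚ.+ ψ j)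
binomialSum-+ zero φ ψ = refl
binomialSum-+ (suc n) φ ψ =
  trans (interchange (binomialSum n φ) (binomialSum n (φ ∘ suc)) (binomialSum n ψ) (binomialSum n (ψ ∘ suc)))
        (cong₂ ℚ._+_ (binomialSum-+ n φ ψ) (binomialSum-+ n (φ ∘ suc) (ψ ∘ suc)))

ℚsum-dist : ∀ n (z : Assignment n) (φ : ℕ → ℚ) → ℚsum (map (λ γ → φ (dist γ z)) (allAssign n)) ≡ binomialSum n φ
ℚsum-dist zero [] φ = ℚP.+-identityʳ (φ 0)
ℚsum-dist (suc n) (true ∷ z) φ =
  trans (ℚsum-allAssign n true _) (cong₂ ℚ._+_ (ℚsum-dist n z φ) (ℚsum-dist n z (φ ∘ suc)))
ℚsum-dist (suc n) (false ∷ z) φ =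
  trans (ℚsum-allAssign n false _) (cong₂ ℚ._+_ (ℚsum-dist n z φ) (ℚsum-dist n z (φ ∘ suc)))

ℚsum-dist-marked : ∀ n (z : Assignment (suc n)) b (G : Bool → ℕ → ℚ) →
  ℚsum (map (λ γ → G (lookup γ b xor lookup z b) (dist γ z)) (allAssign (suc n)))
    ≡ binomialSum n (λ j → G false j ℚ.+ G true (suc j))
ℚsum-dist-marked n (true ∷ z) zero G = trans (ℚsum-allAssign n true _)
  (trans (cong₂ ℚ._+_ (ℚsum-dist n z (G false)) (ℚsum-dist n z (G true ∘ suc))) (binomialSum-+ n _ _))
ℚsum-dist-marked n (false ∷ z) zero G = trans (ℚsum-allAssign n false _)
  (trans (cong₂ ℚ._+_ (ℚsum-dist n z (G false)) (ℚsum-dist n z (G true ∘ suc))) (binomialSum-+ n _ _))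
ℚsum-dist-marked (suc n) (true ∷ z) (suc b) G = trans (ℚsum-allAssign (suc n) true _)
  (cong₂ ℚ._+_ (ℚsum-dist-marked n z b G) (ℚsum-dist-marked n z b (λ c w → G c (suc w))))
ℚsum-dist-marked (suc n) (false ∷ z) (suc b) G = trans (ℚsum-allAssign (suc n) false _)
  (cong₂ ℚ._+_ (ℚsum-dist-marked n z b G) (ℚsum-dist-marked n z b (λ c w → G c (suc w))))

private
  swap-middle : ∀ (H : Bool → Bool → ℕ → ℚ) j →
    (H false false j ℚ.+ H true false (suc j)) ℚ.+ (H false true (suc j) ℚ.+ H true true (suc (suc j)))
      ≡ (H false false j ℚ.+ H false true (suc j)) ℚ.+ (H true false (suc j) ℚ.+ H true true (suc (suc j)))
  swap-middle H j = interchange (H false false j) (H true false (suc j)) (H false true (suc j)) (H true true (suc (suc j)))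

ℚsum-dist-marked₂ : ∀ n (z : Assignment (suc (suc n))) a b → a ≢ b → (H : Bool → Bool → ℕ → ℚ) →
  ℚsum (map (λ γ → H (lookup γ a xor lookup z a) (lookup γ b xor lookup z b) (dist γ z)) (allAssign (suc (suc n))))
    ≡ binomialSum n (λ j → (H false false j ℚ.+ H false true (suc j)) ℚ.+ (H true false (suc j) ℚ.+ H true true (suc (suc j))))
ℚsum-dist-marked₂ n z zero zero a≢b H = ⊥-elim (a≢b refl)
ℚsum-dist-marked₂ n (true ∷ z) zero (suc b) _ H = trans (ℚsum-allAssign (suc n) true _)
  (trans (cong₂ ℚ._+_ (ℚsum-dist-marked n z b (H false)) (ℚsum-dist-marked n z b (λ c w → H true c (suc w))))
         (binomialSum-+ n _ _))
ℚsum-dist-marked₂ n (false ∷ z) zero (suc b) _ H = trans (ℚsum-allAssign (suc n) false _)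
  (trans (cong₂ ℚ._+_ (ℚsum-dist-marked n z b (H false)) (ℚsum-dist-marked n z b (λ c w → H true c (suc w))))
         (binomialSum-+ n _ _))
ℚsum-dist-marked₂ n (true ∷ z) (suc a) zero _ H = trans (ℚsum-allAssign (suc n) true _)
  (trans (cong₂ ℚ._+_ (ℚsum-dist-marked n z a (λ c w → H c false w)) (ℚsum-dist-marked n z a (λ c w → H c true (suc w))))
         (trans (binomialSum-+ n _ _) (binomialSum-cong n (swap-middle H))))
ℚsum-dist-marked₂ n (false ∷ z) (suc a) zero _ H = trans (ℚsum-allAssign (suc n) false _)
  (trans (cong₂ ℚ._+_ (ℚsum-dist-marked n z a (λ c w → H c false w)) (ℚsum-dist-marked n z a (λ c w → H c true (suc w))))
         (trans (binomialSum-+ n _ _) (binomialSum-cong n (swap-middle H))))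
ℚsum-dist-marked₂ zero z (suc zero) (suc zero) a≢b H = ⊥-elim (a≢b refl)
ℚsum-dist-marked₂ (suc n) (true ∷ z) (suc a) (suc b) a≢b H = trans (ℚsum-allAssign (suc (suc n)) true _)
  (cong₂ ℚ._+_ (ℚsum-dist-marked₂ n z a b (a≢b ∘ cong suc) H)
               (ℚsum-dist-marked₂ n z a b (a≢b ∘ cong suc) (λ x y w → H x y (suc w))))
ℚsum-dist-marked₂ (suc n) (false ∷ z) (suc a) (suc b) a≢b H = trans (ℚsum-allAssign (suc (suc n)) false _)
  (cong₂ ℚ._+_ (ℚsum-dist-marked₂ n z a b (a≢b ∘ cong suc) H)
               (ℚsum-dist-marked₂ n z a b (a≢b ∘ cong suc) (λ x y w → H x y (suc w))))

binomialSum-closed : ∀ n (φ : ℕ → ℚ) N → n ℕ.< N → binomialSum n φ ≡ ∑[ j < N ] (fromℕ (n C toℕ j) ℚ.* φ (toℕ j))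
binomialSum-closed zero φ (suc N) _ = sym (begin
  fromℕ 1 ℚ.* φ 0 ℚ.+ ∑[ j < N ] (fromℕ 0 ℚ.* φ (suc (toℕ j)))
    ≡⟨ cong₂ ℚ._+_ (ℚP.*-identityˡ (φ 0))
               (ℚΣ.sum-cong-≗ {N} {λ j → fromℕ 0 ℚ.* φ (suc (toℕ j))} {λ _ → 0ℚ} (λ j → ℚP.*-zeroˡ (φ (suc (toℕ j))))) ⟩
  φ 0 ℚ.+ ∑[ j < N ] 0ℚ
    ≡⟨ cong (φ 0 ℚ.+_) (ℚΣ.sum-replicate-zero N) ⟩
  φ 0 ℚ.+ 0ℚ
    ≡⟨ ℚP.+-identityʳ (φ 0) ⟩
  φ 0 ∎)
  where open ≡-Reasoning
binomialSum-closed (suc m) φ (suc N) (s≤s m<N) = begin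
  binomialSum m φ ℚ.+ binomialSum m (φ ∘ suc)
    ≡⟨ cong₂ ℚ._+_ (binomialSum-closed m φ (suc N) (ℕP.m<n⇒m<1+n m<N)) (binomialSum-closed m (φ ∘ suc) N m<N) ⟩
  (w₀ ℚ.+ ∑[ j < N ] shifted j) ℚ.+ ∑[ j < N ] same j
    ≡⟨ ℚP.+-assoc w₀ _ _ ⟩
  w₀ ℚ.+ (∑[ j < N ] shifted j ℚ.+ ∑[ j < N ] same j)
    ≡⟨ cong (w₀ ℚ.+_) (ℚΣ.∑-distrib-+ shifted same) ⟨
  w₀ ℚ.+ ∑[ j < N ] (shifted j ℚ.+ same j)
    ≡⟨ cong (w₀ ℚ.+_) (ℚΣ.sum-cong-≗ pascal) ⟩
  w₀ ℚ.+ ∑[ j < N ] (fromℕ (suc m C suc (toℕ j)) ℚ.* φ (suc (toℕ j)))  ∎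
  where
  open ≡-Reasoning
  w₀ = fromℕ 1 ℚ.* φ 0
  shifted same : Fin N → ℚ
  shifted j = fromℕ (m C suc (toℕ j)) ℚ.* φ (suc (toℕ j))
  same j = fromℕ (m C toℕ j) ℚ.* φ (suc (toℕ j))
  pascal : ∀ j → shifted j ℚ.+ same j ≡ fromℕ (suc m C suc (toℕ j)) ℚ.* φ (suc (toℕ j))
  pascal j = begin
    shifted j ℚ.+ same j                          ≡⟨ ℚP.*-distribʳ-+ (φ (suc i)) (fromℕ (m C suc i)) (fromℕ (m C i)) ⟨
    (fromℕ (m C suc i) ℚ.+ fromℕ (m C i)) ℚ.* φ (suc i)  ≡⟨ cong (ℚ._* φ (suc i)) (fromℕ-+ (m C suc i) (m C i)) ⟨
    fromℕ (m C suc i ℕ.+ m C i) ℚ.* φ (suc i)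
      ≡⟨ cong (λ c → fromℕ c ℚ.* φ (suc i)) (trans (ℕP.+-comm (m C suc i) (m C i)) (nCk+nC[k+1]≡[n+1]C[k+1] m i)) ⟩
    fromℕ (suc m C suc i) ℚ.* φ (suc i)           ∎
    where i = toℕ j

binomialSum-1 : ∀ n → binomialSum n (λ _ → 1ℚ) ≡ fromℕ (2 ^ n)
binomialSum-1 zero = refl
binomialSum-1 (suc n) = begin
  binomialSum n (λ _ → 1ℚ) ℚ.+ binomialSum n (λ _ → 1ℚ)   ≡⟨ cong₂ ℚ._+_ (binomialSum-1 n) (binomialSum-1 n) ⟩
  fromℕ (2 ^ n) ℚ.+ fromℕ (2 ^ n)                         ≡⟨ fromℕ-+ (2 ^ n) (2 ^ n) ⟨
  fromℕ (2 ^ n ℕ.+ 2 ^ n)                                  ≡⟨ cong (λ m → fromℕ (2 ^ n ℕ.+ m)) (ℕP.+-identityʳ (2 ^ n)) ⟨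
  fromℕ (2 ^ suc n)                                        ∎
  where open ≡-Reasoning

∑-binomial : ∀ n → ∑[ j < suc n ] fromℕ (n C toℕ j) ≡ fromℕ (2 ^ n)
∑-binomial n = begin
  ∑[ j < suc n ] fromℕ (n C toℕ j)           ≡⟨ ℚΣ.sum-cong-≗ {suc n} (λ j → ℚP.*-identityʳ (fromℕ (n C toℕ j))) ⟨
  ∑[ j < suc n ] (fromℕ (n C toℕ j) ℚ.* 1ℚ)  ≡⟨ binomialSum-closed n (λ _ → 1ℚ) (suc n) ℕP.≤-refl ⟨
  binomialSum n (λ _ → 1ℚ)                   ≡⟨ binomialSum-1 n ⟩
  fromℕ (2 ^ n)                              ∎
  where open ≡-Reasoning

χ : ℕ → ℚ
χ j = (j /ℕ suc j) ℚ.* (j /ℕ suc j) ℚ.+ suc j /ℕ suc (suc j) ℚ.+ suc j /ℕ suc (suc j) ℚ.+ 1ℚ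

formula≡binomialSum : ∀ K → formula K ≡ binomialSum K χ ℚ.* (1 /ℕ (2 ^ suc (suc K)))
formula≡binomialSum K = begin
  formula K                                                         ≡⟨ ℚsum-applyUpTo term id (suc K) ⟩
  ∑[ j < suc K ] term (toℕ j)                                       ≡⟨ ℚΣ.sum-cong-≗ {suc K} (term≡ ∘ toℕ) ⟩
  ∑[ j < suc K ] (fromℕ (K C toℕ j) ℚ.* χ (toℕ j) ℚ.* c)
    ≡⟨ ℚΣ.*-distribʳ-sum {suc K} c (λ j → fromℕ (K C toℕ j) ℚ.* χ (toℕ j)) ⟨
  (∑[ j < suc K ] (fromℕ (K C toℕ j) ℚ.* χ (toℕ j))) ℚ.* c
    ≡⟨ cong (ℚ._* c) (binomialSum-closed K χ (suc K) ℕP.≤-refl) ⟨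
  binomialSum K χ ℚ.* c                                             ∎
  where
  open ≡-Reasoning
  c = 1 /ℕ (2 ^ suc (suc K))
  term : ℕ → ℚ
  term j = (1 /ℕ 4) ℚ.* ((K C j) /ℕ (2 ^ K)) ℚ.* χ j
  quarter : (1 /ℕ 4) ℚ.* (1 /ℕ (2 ^ K)) ≡ c
  quarter = trans (/ℕ-* 1 1 4 (2 ^ K) {{_}} {{ℕP.m^n≢0 2 K}}) (cong (1 /ℕ_) (four (2 ^ K)))
    where
    four : ∀ x → 4 ℕ.* x ≡ 2 ℕ.* (2 ℕ.* x)
    four = solve-∀
  term≡ : ∀ j → term j ≡ fromℕ (K C j) ℚ.* χ j ℚ.* c
  term≡ j = begin
    (1 /ℕ 4) ℚ.* ((K C j) /ℕ (2 ^ K)) ℚ.* χ j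
      ≡⟨ cong (λ x → (1 /ℕ 4) ℚ.* x ℚ.* χ j) (fromℕ-*-1/ℕ (K C j) (2 ^ K) {{ℕP.m^n≢0 2 K}}) ⟨
    (1 /ℕ 4) ℚ.* (fromℕ (K C j) ℚ.* (1 /ℕ (2 ^ K))) ℚ.* χ j    ≡⟨ regroup (1 /ℕ 4) (fromℕ (K C j)) (1 /ℕ (2 ^ K)) (χ j) ⟩
    fromℕ (K C j) ℚ.* χ j ℚ.* ((1 /ℕ 4) ℚ.* (1 /ℕ (2 ^ K)))    ≡⟨ cong (fromℕ (K C j) ℚ.* χ j ℚ.*_) quarter ⟩
    fromℕ (K C j) ℚ.* χ j ℚ.* c                               ∎
    where
    regroup : ∀ a b c d → a ℚ.* (b ℚ.* c) ℚ.* d ≡ b ℚ.* d ℚ.* (a ℚ.* c)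
    regroup = solve 4 (λ a b c d → a :* (b :* c) :* d := b :* d :* (a :* c)) refl
      where open +-*-Solver

-- The lower bound

binomial-absorption : ∀ n j → suc j ℕ.* (suc n C suc j) ≡ suc n ℕ.* (n C j)
binomial-absorption zero zero = refl
binomial-absorption zero (suc j) = ℕP.*-zeroʳ (suc (suc j))
binomial-absorption (suc n) zero = trans (ℕP.+-identityʳ _) (trans (nC1≡n (suc (suc n))) (sym (ℕP.*-identityʳ (suc (suc n)))))
binomial-absorption (suc n) (suc j) = begin
  suc (suc j) ℕ.* (suc (suc n) C suc (suc j))       ≡⟨ cong (suc (suc j) ℕ.*_) (nCk+nC[k+1]≡[n+1]C[k+1] (suc n) (suc j)) ⟨
  suc (suc j) ℕ.* (A ℕ.+ B)                          ≡⟨ split (suc j) A B ⟩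
  suc j ℕ.* A ℕ.+ A ℕ.+ suc (suc j) ℕ.* B
    ≡⟨ cong₂ (λ x y → x ℕ.+ A ℕ.+ y) (binomial-absorption n j) (binomial-absorption n (suc j)) ⟩
  suc n ℕ.* (n C j) ℕ.+ A ℕ.+ suc n ℕ.* (n C suc j)  ≡⟨ merge (suc n) (n C j) A (n C suc j) ⟩
  suc n ℕ.* (n C j ℕ.+ n C suc j) ℕ.+ A              ≡⟨ cong (λ x → suc n ℕ.* x ℕ.+ A) (nCk+nC[k+1]≡[n+1]C[k+1] n j) ⟩
  suc n ℕ.* A ℕ.+ A                                  ≡⟨ ℕP.+-comm (suc n ℕ.* A) A ⟩
  suc (suc n) ℕ.* A                                  ∎
  where
  open ≡-Reasoning
  A = suc n C suc j
  B = suc n C suc (suc j)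
  split : ∀ j a b → suc j ℕ.* (a ℕ.+ b) ≡ j ℕ.* a ℕ.+ a ℕ.+ suc j ℕ.* b
  split = solve-∀
  merge : ∀ m x a y → m ℕ.* x ℕ.+ a ℕ.+ m ℕ.* y ≡ m ℕ.* (x ℕ.+ y) ℕ.+ a
  merge = solve-∀

binomial-ratio-≤ : ∀ K j → j ℕ.≤ K → (K C j) ℕ.* suc (suc K) ℕ.≤ (suc K C suc j) ℕ.* suc (suc j)
binomial-ratio-≤ K j j≤K with ℕP.m≤n⇒∃[o]m+o≡n j≤K
... | t , refl = ℕP.*-cancelʳ-≤ _ _ (suc j) (begin
  w ℕ.* suc (suc (j ℕ.+ t)) ℕ.* suc j           ≡⟨ ℕP.*-assoc w _ (suc j) ⟩
  w ℕ.* (suc (suc (j ℕ.+ t)) ℕ.* suc j)         ≤⟨ ℕP.*-monoʳ-≤ w (ℕP.m≤m+n _ t) ⟩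
  w ℕ.* (suc (suc (j ℕ.+ t)) ℕ.* suc j ℕ.+ t)   ≡⟨ cong (w ℕ.*_) (cross j t) ⟩
  w ℕ.* (suc (j ℕ.+ t) ℕ.* suc (suc j))         ≡⟨ rearrange w (suc (j ℕ.+ t)) (suc (suc j)) ⟩
  suc (j ℕ.+ t) ℕ.* w ℕ.* suc (suc j)           ≡⟨ cong (ℕ._* suc (suc j)) (binomial-absorption (j ℕ.+ t) j) ⟨
  suc j ℕ.* c ℕ.* suc (suc j)                   ≡⟨ rotate (suc j) c (suc (suc j)) ⟩
  c ℕ.* suc (suc j) ℕ.* suc j                   ∎)
  where
  open ℕP.≤-Reasoning
  w = (j ℕ.+ t) C j
  c = suc (j ℕ.+ t) C suc j
  cross : ∀ j t → suc (suc (j ℕ.+ t)) ℕ.* suc j ℕ.+ t ≡ suc (j ℕ.+ t) ℕ.* suc (suc j)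
  cross = solve-∀
  rearrange : ∀ w a b → w ℕ.* (a ℕ.* b) ≡ a ℕ.* w ℕ.* b
  rearrange = solve-∀
  rotate : ∀ a c b → a ℕ.* c ℕ.* b ≡ c ℕ.* b ℕ.* a
  rotate = solve-∀

four : ℚ
four = (1ℚ ℚ.+ 1ℚ) ℚ.+ (1ℚ ℚ.+ 1ℚ)

χ-lower-bound : ∀ j → four ℚ.≤ χ j ℚ.+ (1 /ℕ suc j ℚ.+ 1 /ℕ suc j) ℚ.+ (1 /ℕ suc (suc j) ℚ.+ 1 /ℕ suc (suc j))
χ-lower-bound j = begin
  four                                                ≡⟨ ℚP.+-identityʳ four ⟨
  four ℚ.+ 0ℚ                                         ≤⟨ ℚP.+-monoʳ-≤ four U²≥0 ⟩
  four ℚ.+ U ℚ.* U                                    ≡⟨ expand U V ⟨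
  (1ℚ ℚ.- U) ℚ.* (1ℚ ℚ.- U) ℚ.+ (1ℚ ℚ.- V) ℚ.+ (1ℚ ℚ.- V) ℚ.+ 1ℚ ℚ.+ (U ℚ.+ U) ℚ.+ (V ℚ.+ V)
    ≡⟨ cong₂ (λ a b → a ℚ.* a ℚ.+ b ℚ.+ b ℚ.+ 1ℚ ℚ.+ (U ℚ.+ U) ℚ.+ (V ℚ.+ V)) (/ℕ-complement j) (/ℕ-complement (suc j)) ⟨
  χ j ℚ.+ (U ℚ.+ U) ℚ.+ (V ℚ.+ V)                     ∎
  where
  open ℚP.≤-Reasoning
  U = 1 /ℕ suc j
  V = 1 /ℕ suc (suc j)
  U²≥0 : 0ℚ ℚ.≤ U ℚ.* U
  U²≥0 = ℚP.nonNegative⁻¹ (U ℚ.* U) {{ℚP.nonNeg*nonNeg⇒nonNeg U {{U≥0}} U {{U≥0}}}}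
    where U≥0 = ℚ.nonNegative (/ℕ-nonNeg 1 (suc j))
  expand : ∀ U V → (1ℚ ℚ.- U) ℚ.* (1ℚ ℚ.- U) ℚ.+ (1ℚ ℚ.- V) ℚ.+ (1ℚ ℚ.- V) ℚ.+ 1ℚ ℚ.+ (U ℚ.+ U) ℚ.+ (V ℚ.+ V)
                   ≡ four ℚ.+ U ℚ.* U
  expand = solve 2 (λ U V → (con 1ℚ :- U) :* (con 1ℚ :- U) :+ (con 1ℚ :- V) :+ (con 1ℚ :- V) :+ con 1ℚ :+ (U :+ U) :+ (V :+ V)
                            := (con 1ℚ :+ con 1ℚ) :+ (con 1ℚ :+ con 1ℚ) :+ U :* U) refl
    where open +-*-Solver

binomial-term-bound : ∀ K j → j ℕ.≤ K →
  fromℕ (K C j) ℚ.* four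
    ℚ.≤ fromℕ (K C j) ℚ.* χ j ℚ.+ (fromℕ (suc K C suc j) ℚ.+ fromℕ (suc K C suc j)) ℚ.* (1 /ℕ suc K ℚ.+ 1 /ℕ suc (suc K))
binomial-term-bound K j j≤K = begin
  W ℚ.* four                                                       ≤⟨ ℚP.*-monoˡ-≤-nonNeg W {{W≥0}} (χ-lower-bound j) ⟩
  W ℚ.* (χ j ℚ.+ (U ℚ.+ U) ℚ.+ (V ℚ.+ V))                          ≡⟨ distribute W (χ j) U V ⟩
  W ℚ.* χ j ℚ.+ ((W ℚ.* U ℚ.+ W ℚ.* U) ℚ.+ (W ℚ.* V ℚ.+ W ℚ.* V))
    ≡⟨ cong (λ x → W ℚ.* χ j ℚ.+ ((x ℚ.+ x) ℚ.+ (W ℚ.* V ℚ.+ W ℚ.* V))) WU≡CP ⟩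
  W ℚ.* χ j ℚ.+ ((Cc ℚ.* P ℚ.+ Cc ℚ.* P) ℚ.+ (W ℚ.* V ℚ.+ W ℚ.* V))
    ≤⟨ ℚP.+-monoʳ-≤ (W ℚ.* χ j) (ℚP.+-monoʳ-≤ (Cc ℚ.* P ℚ.+ Cc ℚ.* P) (ℚP.+-mono-≤ WV≤CQ WV≤CQ)) ⟩
  W ℚ.* χ j ℚ.+ ((Cc ℚ.* P ℚ.+ Cc ℚ.* P) ℚ.+ (Cc ℚ.* Q ℚ.+ Cc ℚ.* Q)) ≡⟨ collect (W ℚ.* χ j) Cc P Q ⟩
  W ℚ.* χ j ℚ.+ (Cc ℚ.+ Cc) ℚ.* (P ℚ.+ Q)                          ∎
  where
  open ℚP.≤-Reasoning
  w = K C j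
  c = suc K C suc j
  W = fromℕ w
  Cc = fromℕ c
  U = 1 /ℕ suc j
  V = 1 /ℕ suc (suc j)
  P = 1 /ℕ suc K
  Q = 1 /ℕ suc (suc K)
  W≥0 : ℚ.NonNegative W
  W≥0 = ℚ.nonNegative (/ℕ-nonNeg w 1)
  WU≡CP : W ℚ.* U ≡ Cc ℚ.* P
  WU≡CP = begin-equality
    W ℚ.* U         ≡⟨ fromℕ-*-1/ℕ w (suc j) ⟩
    w /ℕ suc j      ≡⟨ /ℕ-cross-≡ {w} {c} {suc j} {suc K} cross ⟩
    c /ℕ suc K      ≡⟨ fromℕ-*-1/ℕ c (suc K) ⟨
    Cc ℚ.* P        ∎
    where
    cross : w ℕ.* suc K ≡ c ℕ.* suc j
    cross = trans (ℕP.*-comm w (suc K)) (trans (sym (binomial-absorption K j)) (ℕP.*-comm (suc j) c))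
  WV≤CQ : W ℚ.* V ℚ.≤ Cc ℚ.* Q
  WV≤CQ = begin
    W ℚ.* V             ≡⟨ fromℕ-*-1/ℕ w (suc (suc j)) ⟩
    w /ℕ suc (suc j)    ≤⟨ /ℕ-cross-≤ {w} {c} {suc (suc j)} {suc (suc K)} (binomial-ratio-≤ K j j≤K) ⟩
    c /ℕ suc (suc K)    ≡⟨ fromℕ-*-1/ℕ c (suc (suc K)) ⟨
    Cc ℚ.* Q            ∎
  distribute : ∀ W X U V →
    W ℚ.* (X ℚ.+ (U ℚ.+ U) ℚ.+ (V ℚ.+ V)) ≡ W ℚ.* X ℚ.+ ((W ℚ.* U ℚ.+ W ℚ.* U) ℚ.+ (W ℚ.* V ℚ.+ W ℚ.* V))
  distribute = solve 4 (λ W X U V →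
    W :* (X :+ (U :+ U) :+ (V :+ V)) := W :* X :+ ((W :* U :+ W :* U) :+ (W :* V :+ W :* V))) refl
    where open +-*-Solver
  collect : ∀ Y C P Q → Y ℚ.+ ((C ℚ.* P ℚ.+ C ℚ.* P) ℚ.+ (C ℚ.* Q ℚ.+ C ℚ.* Q)) ≡ Y ℚ.+ (C ℚ.+ C) ℚ.* (P ℚ.+ Q)
  collect = solve 4 (λ Y C P Q → Y :+ ((C :* P :+ C :* P) :+ (C :* Q :+ C :* Q)) := Y :+ (C :+ C) :* (P :+ Q)) refl
    where open +-*-Solver

∑-binomial-shifted-≤ : ∀ K → ∑[ j < suc K ] fromℕ (suc K C suc (toℕ j)) ℚ.≤ fromℕ (2 ^ suc K)
∑-binomial-shifted-≤ K = begin
  ∑C                 ≡⟨ ℚP.+-identityˡ ∑C ⟨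
  0ℚ ℚ.+ ∑C          ≤⟨ ℚP.+-monoˡ-≤ ∑C (/ℕ-nonNeg 1 1) ⟩
  fromℕ 1 ℚ.+ ∑C     ≡⟨ ∑-binomial (suc K) ⟩
  fromℕ (2 ^ suc K)  ∎
  where
  open ℚP.≤-Reasoning
  ∑C = ∑[ j < suc K ] fromℕ (suc K C suc (toℕ j))

∑-binomial-χ-bound : ∀ K → let N = fromℕ (2 ^ suc (suc K)) in
  N ℚ.≤ ∑[ j < suc K ] (fromℕ (K C toℕ j) ℚ.* χ (toℕ j)) ℚ.+ N ℚ.* (1 /ℕ suc K ℚ.+ 1 /ℕ suc (suc K))
∑-binomial-χ-bound K = begin
  fromℕ (2 ^ suc (suc K))                              ≡⟨ N≡X*four ⟩
  fromℕ (2 ^ K) ℚ.* four                               ≡⟨ cong (ℚ._* four) (∑-binomial K) ⟨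
  (∑[ j < suc K ] W j) ℚ.* four                        ≡⟨ ℚΣ.*-distribʳ-sum four W ⟩
  ∑[ j < suc K ] (W j ℚ.* four)
    ≤⟨ ∑-mono-≤ (λ j → binomial-term-bound K (toℕ j) (ℕP.≤-pred (FinP.toℕ<n j))) ⟩
  ∑[ j < suc K ] (W j ℚ.* χ (toℕ j) ℚ.+ (Cc j ℚ.+ Cc j) ℚ.* R)
    ≡⟨ ℚΣ.∑-distrib-+ (λ j → W j ℚ.* χ (toℕ j)) (λ j → (Cc j ℚ.+ Cc j) ℚ.* R) ⟩
  S ℚ.+ ∑[ j < suc K ] ((Cc j ℚ.+ Cc j) ℚ.* R)        ≡⟨ cong (S ℚ.+_) (ℚΣ.*-distribʳ-sum R (λ j → Cc j ℚ.+ Cc j)) ⟨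
  S ℚ.+ (∑[ j < suc K ] (Cc j ℚ.+ Cc j)) ℚ.* R        ≡⟨ cong (λ x → S ℚ.+ x ℚ.* R) (ℚΣ.∑-distrib-+ Cc Cc) ⟩
  S ℚ.+ (∑[ j < suc K ] Cc j ℚ.+ ∑[ j < suc K ] Cc j) ℚ.* R
    ≤⟨ ℚP.+-monoʳ-≤ S (ℚP.*-monoʳ-≤-nonNeg R {{R≥0}} (ℚP.+-mono-≤ (∑-binomial-shifted-≤ K) (∑-binomial-shifted-≤ K))) ⟩
  S ℚ.+ (fromℕ (2 ^ suc K) ℚ.+ fromℕ (2 ^ suc K)) ℚ.* R ≡⟨ cong (λ x → S ℚ.+ x ℚ.* R) (fromℕ-2^suc (suc K)) ⟨
  S ℚ.+ fromℕ (2 ^ suc (suc K)) ℚ.* R                  ∎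
  where
  open ℚP.≤-Reasoning
  R = 1 /ℕ suc K ℚ.+ 1 /ℕ suc (suc K)
  W Cc : Fin (suc K) → ℚ
  W j = fromℕ (K C toℕ j)
  Cc j = fromℕ (suc K C suc (toℕ j))
  S = ∑[ j < suc K ] (W j ℚ.* χ (toℕ j))
  R≥0 : ℚ.NonNegative R
  R≥0 = ℚ.nonNegative (ℚP.+-mono-≤ (/ℕ-nonNeg 1 (suc K)) (/ℕ-nonNeg 1 (suc (suc K))))
  N≡X*four : fromℕ (2 ^ suc (suc K)) ≡ fromℕ (2 ^ K) ℚ.* four
  N≡X*four = trans (fromℕ-2^suc (suc K)) (trans (cong₂ ℚ._+_ (fromℕ-2^suc K) (fromℕ-2^suc K)) (quadruple (fromℕ (2 ^ K))))
    where
    quadruple : ∀ x → (x ℚ.+ x) ℚ.+ (x ℚ.+ x) ≡ x ℚ.* four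
    quadruple = solve 1 (λ x → (x :+ x) :+ (x :+ x) := x :* ((con 1ℚ :+ con 1ℚ) :+ (con 1ℚ :+ con 1ℚ))) refl
      where open +-*-Solver

formula-lower-bound : ∀ K → 1ℚ ℚ.- 1 /ℕ suc K ℚ.- 1 /ℕ suc (suc K) ℚ.≤ formula K
formula-lower-bound K = begin
  1ℚ ℚ.- P ℚ.- Q                ≡⟨ regroup 1ℚ P Q ⟩
  1ℚ ℚ.- R                      ≡⟨ cong (ℚ._- R) N*ι≡1 ⟨
  N ℚ.* ι ℚ.- R                 ≤⟨ ℚP.+-monoˡ-≤ (ℚ.- R) (ℚP.*-monoʳ-≤-nonNeg ι {{ι≥0}} (∑-binomial-χ-bound K)) ⟩
  (S ℚ.+ N ℚ.* R) ℚ.* ι ℚ.- R   ≡⟨ spread S N R ι ⟩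
  S ℚ.* ι ℚ.+ (N ℚ.* ι ℚ.- 1ℚ) ℚ.* R  ≡⟨ cong₂ (λ a b → a ℚ.+ (b ℚ.- 1ℚ) ℚ.* R) (sym formula≡S*ι) N*ι≡1 ⟩
  formula K ℚ.+ (1ℚ ℚ.- 1ℚ) ℚ.* R     ≡⟨ cancel (formula K) R ⟩
  formula K                     ∎
  where
  open ℚP.≤-Reasoning
  P = 1 /ℕ suc K
  Q = 1 /ℕ suc (suc K)
  R = P ℚ.+ Q
  N = fromℕ (2 ^ suc (suc K))
  ι = 1 /ℕ (2 ^ suc (suc K))
  S = ∑[ j < suc K ] (fromℕ (K C toℕ j) ℚ.* χ (toℕ j))
  ι≥0 : ℚ.NonNegative ι
  ι≥0 = ℚ.nonNegative (/ℕ-nonNeg 1 (2 ^ suc (suc K)) {{ℕP.m^n≢0 2 (suc (suc K))}})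
  N*ι≡1 : N ℚ.* ι ≡ 1ℚ
  N*ι≡1 = trans (fromℕ-*-1/ℕ (2 ^ suc (suc K)) _ {{ℕP.m^n≢0 2 (suc (suc K))}})
                (/ℕ-self (2 ^ suc (suc K)) {{ℕP.m^n≢0 2 (suc (suc K))}})
  formula≡S*ι : formula K ≡ S ℚ.* ι
  formula≡S*ι = trans (formula≡binomialSum K) (cong (ℚ._* ι) (binomialSum-closed K χ (suc K) ℕP.≤-refl))
  regroup : ∀ a p q → a ℚ.- p ℚ.- q ≡ a ℚ.- (p ℚ.+ q)
  regroup = solve 3 (λ a p q → a :- p :- q := a :- (p :+ q)) refl
    where open +-*-Solver
  spread : ∀ s n r i → (s ℚ.+ n ℚ.* r) ℚ.* i ℚ.- r ≡ s ℚ.* i ℚ.+ (n ℚ.* i ℚ.- 1ℚ) ℚ.* r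
  spread = solve 4 (λ s n r i → (s :+ n :* r) :* i :- r := s :* i :+ (n :* i :- con 1ℚ) :* r) refl
    where open +-*-Solver
  cancel : ∀ f r → f ℚ.+ (1ℚ ℚ.- 1ℚ) ℚ.* r ≡ f
  cancel = solve 2 (λ f r → f :+ (con 1ℚ :- con 1ℚ) :* r := f) refl
    where open +-*-Solver

prSat≡formula : ∀ K (ℓ : Clause (suc (suc K))) → ClauseDistinctVars ℓ
  → (αs αe : Assignment (suc (suc K)))
  → ExactlyOneTrue ℓ αs → ExactlyOneTrue ℓ αe → αs ≢ αe
  → (E : Assignment (suc (suc K)) → Assignment (suc (suc K)) → List (List (Assignment (suc (suc K)))))
  → (∀ α β s → s ∈ E α β → Irredundant α β s)
  → (∀ α β s → Irredundant α β s → s ∈ E α β)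
  → (∀ α β → Unique (E α β))
  → prSat ℓ E αs αe ≡ formula K
prSat≡formula K ℓ distinct αs αe αs-one αe-one αs≢αe E E-sound E-complete E-unique
  with Falsifier.exactlyOneTrue⇒neighbour ℓ distinct αs αs-one | Falsifier.exactlyOneTrue⇒neighbour ℓ distinct αe αe-one
... | a , refl | b , refl = begin
  prSat ℓ E (z [ a ]%= not) (z [ b ]%= not)
    ≡⟨ avg-cong (allAssign k) (λ γ → avg-all-++ (satC ℓ) (E (z [ a ]%= not) γ) (E γ (z [ b ]%= not))) ⟩
  avg (allAssign k) (λ γ → Pr (z [ a ]%= not) γ ℚ.* Pr γ (z [ b ]%= not))
    ≡⟨ avg-cong (allAssign k) (λ γ → cong₂ ℚ._*_ (Pr-from-neighbour a γ) (Pr-to-neighbour b γ)) ⟩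
  avg (allAssign k) (λ γ → H (lookup γ a xor lookup z a) (lookup γ b xor lookup z b) (dist γ z))
    ≡⟨ cong₂ ℚ._*_ (ℚsum-dist-marked₂ K z a b a≢b H) (cong (1 /ℕ_) (length-allAssign k)) ⟩
  binomialSum K (λ j → (H false false j ℚ.+ H false true (suc j)) ℚ.+ (H true false (suc j) ℚ.+ H true true (suc (suc j))))
    ℚ.* (1 /ℕ (2 ^ k))
    ≡⟨ cong (ℚ._* (1 /ℕ (2 ^ k))) (binomialSum-cong K (λ j → regroup (j /ℕ suc j) (suc j /ℕ suc (suc j)))) ⟩
  binomialSum K χ ℚ.* (1 /ℕ (2 ^ k))
    ≡⟨ formula≡binomialSum K ⟨
  formula K ∎
  where
  open ≡-Reasoning
  k = suc (suc K)
  open Falsifier ℓ distinct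
  open Enumeration E E-sound E-complete E-unique
  open Avoiding z (satC ℓ) satC-z satC-≢z
  H : Bool → Bool → ℕ → ℚ
  H x y w = pAvoid x w ℚ.* pAvoid y w
  a≢b : a ≢ b
  a≢b refl = αs≢αe refl
  regroup : ∀ p q → p ℚ.* p ℚ.+ q ℚ.* 1ℚ ℚ.+ (1ℚ ℚ.* q ℚ.+ 1ℚ ℚ.* 1ℚ) ≡ p ℚ.* p ℚ.+ q ℚ.+ q ℚ.+ 1ℚ
  regroup = solve 2 (λ p q → p :* p :+ q :* con 1ℚ :+ (con 1ℚ :* q :+ con 1ℚ :* con 1ℚ) := p :* p :+ q :+ q :+ con 1ℚ) refl
    where open +-*-Solver

claim5p4 : (k : ℕ) → 3 ≤ k
    → (ℓ : Clause k) → ClauseDistinctVars ℓ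
    → (αs αe : Assignment k)
    → ExactlyOneTrue ℓ αs → ExactlyOneTrue ℓ αe → αs ≢ αe
    → (E : Assignment k → Assignment k → List (List (Assignment k)))
    → (∀ α β s → s ∈ E α β → Irredundant α β s)
    → (∀ α β s → Irredundant α β s → s ∈ E α β)
    → (∀ α β → Unique (E α β))
    → (prSat ℓ E αs αe ≡ formula (k ∸ 2))
      × (1ℚ ℚ.- (1 /ℕ (k ∸ 1)) ℚ.- (1 /ℕ k) ℚ.≤ formula (k ∸ 2))
claim5p4 (suc (suc K)) (s≤s (s≤s _)) ℓ distinct αs αe αs-one αe-one αs≢αe E E-sound E-complete E-unique =
  prSat≡formula K ℓ distinct αs αe αs-one αe-one αs≢αe E E-sound E-complete E-unique ,
  formula-lower-bound K
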